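{- Let $0<\varepsilon<1/2$ and $\delta=0.03\varepsilon$. Let $L,R$ be disjoint subsets of $[n]$, let $D\subseteq L\times R$ be a set of arcs, and put $l=|L|+|R|$, $\gamma=|L|/l$, $\lambda=2\delta$ and $\zeta=\varepsilon\delta\gamma(1-\gamma)/4$. Let $X,Y$ be disjoint subsets of $[n]$ with $|X|=|L|$, $|Y|=|R|$, and let $I_1\cup\dots\cup I_r$ be the partition of $X\cup Y$ into $r=1/\lambda$ consecutive intervals (with respect to the usual order on $[n]$) of size $\lambda l$ each. If $D$ is $\delta$-regular and \[ |X\cap I_j|\in[(\gamma\lambda-\zeta)l,\ (\gamma\lambda+\zeta)l]\quad\text{for all } j\in[r], \] then $(X,Y)$ is safe for $D$.
   Context: An interval of a set $Z=\{i_1<\dots<i_u\}\subseteq[n]$ is a set of the form $\{i_s,\dots,i_{s+t}\}$. The quantities $\lambda l$ and $1/\lambda$ are treated as integers. For a set of arcs $D\subseteq L\times R$ ($L,R$ disjoint), its density on $L'\subseteq L$, $R'\subseteq R$ is $d_D(L',R')=|D\cap(L'\times R')|/(|L'||R'|)$, and $D$ is $\delta$-regular if $|d_D(L',R')-d_D(L,R)|<\delta$ whenever $|L'|>\delta|L|$ and $|R'|>\delta|R|$. For an injective map $\tau$ from $L\cup R$ into $[n]$, $\mathrm{fit}(\tau,D)=|\{(u,v)\in D:\tau(u)<\tau(v)\}|-|\{(u,v)\in D:\tau(u)>\tau(v)\}|$. A pair $(X,Y)$ of disjoint subsets of $[n]$ with $|X|=|L|$, $|Y|=|R|$ is safe for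 $D$ if $\mathrm{fit}(\tau,D)<\varepsilon|L||R|/4$ for every bijection $\tau:L\cup R\to X\cup Y$ with $\tau(L)=X$. -}

module Defs where

open import Data.Bool using (Bool; true; false; if_then_else_; _∧_; _∨_)
open import Data.Nat as ℕ using (ℕ; zero; suc)
open import Data.Fin using (Fin; zero; suc)
import Data.Fin
open import Data.Fin.Subset using (Subset; _∈_; _⊆_; _∪_; ∣_∣)
open import Data.Vec using (lookup)
open import Data.Integer as ℤ using (ℤ; +_)
open import Data.Rational as ℚ using (ℚ; 0ℚ; _/_; _+_; _-_; _*_; _<_; _≤_)
open import Data.Product using (_×_; Σ-syntax)
open import Data.Empty using (⊥)
open import Relation.Binary.PropositionalEquality using (_≡_)
open import Relation.Nullary.Decidable using (⌊_⌋)

sumFin : ∀ {n} → (Fin n → ℕ) → ℕ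
sumFin {zero} f = 0
sumFin {suc n} f = f zero ℕ.+ sumFin (λ i → f (suc i))

ind : Bool → ℕ
ind b = if b then 1 else 0

⟦_⟧ : ℕ → ℚ
⟦ k ⟧ = + k / 1

-- quotient of naturals; the divisor is always positive where used
-- (convention k ÷ 0 = 0 is never relevant)
_÷ℕ_ : ℕ → ℕ → ℚ
k ÷ℕ zero = 0ℚ
k ÷ℕ suc d = + k / suc d

Arcs : ℕ → Set
Arcs n = Fin n → Fin n → Bool

ArcsIn : ∀ {n} → Arcs n → Subset n → Subset n → Set
ArcsIn D L R = ∀ u v → D u v ≡ true → (u ∈ L) × (v ∈ R)

Disjoint : ∀ {n} → Subset n → Subset n → Set
Disjoint A B = ∀ i → i ∈ A → i ∈ B → ⊥

arcCount : ∀ {n} → Arcs n → Subset n → Subset n → ℕ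
arcCount D L' R' =
  sumFin (λ u → sumFin (λ v → ind (lookup L' u ∧ lookup R' v ∧ D u v)))

density : ∀ {n} → Arcs n → Subset n → Subset n → ℚ
density D L' R' = arcCount D L' R' ÷ℕ (∣ L' ∣ ℕ.* ∣ R' ∣)

Regular : ∀ {n} → ℚ → Arcs n → Subset n → Subset n → Set
Regular δ D L R =
  ∀ L' R' → L' ⊆ L → R' ⊆ R →
  δ * ⟦ ∣ L ∣ ⟧ < ⟦ ∣ L' ∣ ⟧ → δ * ⟦ ∣ R ∣ ⟧ < ⟦ ∣ R' ∣ ⟧ →
  ℚ.∣ density D L' R' - density D L R ∣ < δ

fit : ∀ {n} → (Fin n → Fin n) → Arcs n → ℤ
fit τ D =
  (+ sumFin (λ u → sumFin (λ v → ind (D u v ∧ ⌊ τ u Data.Fin.<? τ v ⌋))))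
  ℤ.- (+ sumFin (λ u → sumFin (λ v → ind (D u v ∧ ⌊ τ v Data.Fin.<? τ u ⌋))))

-- τ restricted to L ∪ R is a bijection onto X ∪ Y with τ(L) = X
-- (values of τ outside L ∪ R are irrelevant)
IsAdmissible : ∀ {n} → Subset n → Subset n → Subset n → Subset n →
               (Fin n → Fin n) → Set
IsAdmissible {n} L R X Y τ =
  (∀ u → u ∈ L ∪ R → τ u ∈ X ∪ Y) ×
  (∀ u v → u ∈ L ∪ R → v ∈ L ∪ R → τ u ≡ τ v → u ≡ v) ×
  (∀ x → x ∈ X ∪ Y → Σ[ u ∈ Fin n ] (u ∈ L ∪ R × τ u ≡ x)) ×
  (∀ u → u ∈ L → τ u ∈ X) ×
  (∀ x → x ∈ X → Σ[ u ∈ Fin n ] (u ∈ L × τ u ≡ x))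

Safe : ∀ {n} → ℚ → Arcs n → Subset n → Subset n → Subset n → Subset n → Set
Safe ε D L R X Y =
  ∀ τ → IsAdmissible L R X Y τ →
  (fit τ D / 1) < ε * ⟦ ∣ L ∣ ℕ.* ∣ R ∣ ⟧ * (+ 1 / 4)

rankIn : ∀ {n} → Subset n → Fin n → ℕ
rankIn Z i = sumFin (λ k → ind (lookup Z k ∧ ⌊ k Data.Fin.<? i ⌋))

-- j-th (0-indexed) interval of Z when Z is cut into consecutive intervals
-- of size m: the elements of Z of rank in [j m, (j+1) m)
inInterval : ∀ {n} → Subset n → ℕ → ℕ → Fin n → Bool
inInterval Z m j i =
  lookup Z i ∧ ⌊ j ℕ.* m ℕ.≤? rankIn Z i ⌋ ∧ ⌊ rankIn Z i ℕ.<? suc j ℕ.* m ⌋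

countInInterval : ∀ {n} → Subset n → Subset n → ℕ → ℕ → ℕ
countInInterval X Z m j = sumFin (λ i → ind (lookup X i ∧ inInterval Z m j i))

module Submission where

-- Fix an admissible τ.  Sorting the points of L and R by the interval their
-- image lies in gives parts L_i, R_i with |L_i| = |X ∩ I_i| ≈ γ m and
-- |L_i| + |R_i| = m.  An arc from L_i to R_j can be oriented forwards only if
-- i ≤ j, and is oriented backwards whenever i > j, so fit(τ, D) ≤ U - V where
-- U and V sum the arc counts e(L_i , R_j) over i ≤ j and over i > j.  Every
-- part exceeds a δ-fraction of its side, so regularity gives
-- e(L_i , R_j) ≈ d |L_i| |R_j|; since the |L_i| are nearly equal, the pairs
-- i ≤ j carry only slightly more than half of |L| |R|, whence
-- U - V < ε |L| |R| / 4.  The modules below provide, in order: finite sums,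
-- ranks and intervals, sums over subsets, the parts and the bound
-- fit ≤ U - V, the estimate of U - V over ℕ, and the translation of the
-- rational hypotheses into statements about naturals.

module FiniteSums where

  open import Defs
  open import Data.Bool using (true; false; _∧_)
  open import Data.Bool.Properties using (∧-zeroʳ)
  open import Data.Nat as ℕ using (ℕ; zero; suc; _+_; _*_; _≤_; _<_; z≤n)
  open import Data.Nat.Properties hiding (suc-injective)
  open import Data.Sum using (inj₁; inj₂)
  open import Relation.Binary.Definitions using (tri<; tri≈; tri>)
  open import Data.Fin using (Fin; zero; suc; toℕ; fromℕ<)
  open import Data.Fin.Properties using (suc-injective; toℕ-injective; toℕ-fromℕ<)
  open import Data.Fin.Subset using (Subset; ∣_∣)
  open import Data.Vec using ([]; _∷_; lookup)
  open import Function using (_∘_)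
  open import Relation.Binary.PropositionalEquality
  open import Relation.Nullary using (Dec; yes; no; ¬_)
  open import Relation.Nullary.Decidable using (⌊_⌋; isYes≗does; dec-true; dec-false)
  open import Algebra.Properties.Semiring.Sum +-*-semiring
    using (sum; sum-cong-≗; ∑-distrib-+; ∑-comm; *-distribˡ-sum)

  -- `sumFin` is the library's finite sum over ℕ written out by recursion;
  -- identifying the two lets us reuse the library's algebra of sums.
  sumFin≡sum : ∀ {n} (f : Fin n → ℕ) → sumFin f ≡ sum f
  sumFin≡sum {zero} f = refl
  sumFin≡sum {suc n} f = cong (f zero +_) (sumFin≡sum (f ∘ suc))

  sum-cong : ∀ {n} {f g : Fin n → ℕ} → (∀ i → f i ≡ g i) → sumFin f ≡ sumFin g
  sum-cong {f = f} {g} f≗g =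
    trans (sumFin≡sum f) (trans (sum-cong-≗ f≗g) (sym (sumFin≡sum g)))

  sum-+ : ∀ {n} (f g : Fin n → ℕ) →
          sumFin (λ i → f i + g i) ≡ sumFin f + sumFin g
  sum-+ f g = trans (sumFin≡sum (λ i → f i + g i)) (trans (∑-distrib-+ f g)
                    (sym (cong₂ _+_ (sumFin≡sum f) (sumFin≡sum g))))

  sum-*ˡ : ∀ {n} (c : ℕ) (f : Fin n → ℕ) → sumFin (λ i → c * f i) ≡ c * sumFin f
  sum-*ˡ c f = trans (sumFin≡sum (λ i → c * f i)) (trans (sym (*-distribˡ-sum c f))
                     (cong (c *_) (sym (sumFin≡sum f))))

  sum-*ʳ : ∀ {n} (c : ℕ) (f : Fin n → ℕ) → sumFin (λ i → f i * c) ≡ sumFin f * c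
  sum-*ʳ c f = trans (sum-cong (λ i → *-comm (f i) c))
                     (trans (sum-*ˡ c f) (*-comm c (sumFin f)))

  sum-swap : ∀ {m n} (f : Fin m → Fin n → ℕ) →
             sumFin (λ i → sumFin (f i)) ≡ sumFin (λ j → sumFin (λ i → f i j))
  sum-swap f = begin
    sumFin (λ i → sumFin (f i))               ≡⟨ sum-cong (λ i → sumFin≡sum (f i)) ⟩
    sumFin (λ i → sum (f i))                  ≡⟨ sumFin≡sum (λ i → sum (f i)) ⟩
    sum (λ i → sum (f i))                     ≡⟨ ∑-comm f ⟩
    sum (λ j → sum (λ i → f i j))             ≡⟨ sumFin≡sum (λ j → sum (λ i → f i j)) ⟨
    sumFin (λ j → sum (λ i → f i j))          ≡⟨ sum-cong (λ j → sumFin≡sum (λ i → f i j)) ⟨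
    sumFin (λ j → sumFin (λ i → f i j))       ∎
    where open ≡-Reasoning

  sum-swap-pairs : ∀ {a b c d} (f : Fin a → Fin b → Fin c → Fin d → ℕ) →
    sumFin (λ i → sumFin (λ j → sumFin (λ u → sumFin (λ v → f i j u v)))) ≡
    sumFin (λ u → sumFin (λ v → sumFin (λ i → sumFin (λ j → f i j u v))))
  sum-swap-pairs f = begin
    sumFin (λ i → sumFin (λ j → sumFin (λ u → sumFin (λ v → f i j u v))))
      ≡⟨ sum-cong (λ i → sum-swap (λ j u → sumFin (λ v → f i j u v))) ⟩
    sumFin (λ i → sumFin (λ u → sumFin (λ j → sumFin (λ v → f i j u v))))
      ≡⟨ sum-swap (λ i u → sumFin (λ j → sumFin (λ v → f i j u v))) ⟩
    sumFin (λ u → sumFin (λ i → sumFin (λ j → sumFin (λ v → f i j u v))))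
      ≡⟨ sum-cong (λ u → sum-cong (λ i → sum-swap (λ j v → f i j u v))) ⟩
    sumFin (λ u → sumFin (λ i → sumFin (λ v → sumFin (λ j → f i j u v))))
      ≡⟨ sum-cong (λ u → sum-swap (λ i v → sumFin (λ j → f i j u v))) ⟩
    sumFin (λ u → sumFin (λ v → sumFin (λ i → sumFin (λ j → f i j u v)))) ∎
    where open ≡-Reasoning

  sum-mono : ∀ {n} {f g : Fin n → ℕ} → (∀ i → f i ≤ g i) → sumFin f ≤ sumFin g
  sum-mono {zero} f≤g = z≤n
  sum-mono {suc n} f≤g = +-mono-≤ (f≤g zero) (sum-mono (f≤g ∘ suc))

  sum-const : ∀ {n} (c : ℕ) → sumFin {n} (λ _ → c) ≡ n * c
  sum-const {zero} c = refl
  sum-const {suc n} c = cong (c +_) (sum-const {n} c)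

  sum-zero : ∀ {n} {f : Fin n → ℕ} → (∀ i → f i ≡ 0) → sumFin f ≡ 0
  sum-zero {n} f≗0 = trans (sum-cong f≗0) (trans (sum-const {n} 0) (*-comm n 0))

  sum-point : ∀ {n} (f : Fin n → ℕ) (k : Fin n) →
              (∀ i → i ≢ k → f i ≡ 0) → sumFin f ≡ f k
  sum-point f zero off = trans (cong (f zero +_) (sum-zero (λ i → off (suc i) λ ())))
                               (+-identityʳ (f zero))
  sum-point f (suc k) off =
    cong₂ _+_ (off zero λ ())
              (sum-point (f ∘ suc) k (λ i i≢k → off (suc i) (i≢k ∘ suc-injective)))

  card≡sum : ∀ {n} (S : Subset n) → ∣ S ∣ ≡ sumFin (λ i → ind (lookup S i))
  card≡sum [] = refl
  card≡sum (true ∷ S) = cong suc (card≡sum S)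
  card≡sum (false ∷ S) = card≡sum S

  ⌊⌋-yes : ∀ {P : Set} (d : Dec P) → P → ⌊ d ⌋ ≡ true
  ⌊⌋-yes d p = trans (isYes≗does d) (dec-true d p)

  ⌊⌋-no : ∀ {P : Set} (d : Dec P) → ¬ P → ⌊ d ⌋ ≡ false
  ⌊⌋-no d ¬p = trans (isYes≗does d) (dec-false d ¬p)

  ⌊⌋-cong : ∀ {P Q : Set} (d : Dec P) (e : Dec Q) → (P → Q) → (Q → P) → ⌊ d ⌋ ≡ ⌊ e ⌋
  ⌊⌋-cong (yes p) e P→Q Q→P = sym (⌊⌋-yes e (P→Q p))
  ⌊⌋-cong (no ¬p) e P→Q Q→P = sym (⌊⌋-no e (¬p ∘ Q→P))

  ind-∧ : ∀ a b → ind (a ∧ b) ≡ ind a * ind b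
  ind-∧ false b = refl
  ind-∧ true b = sym (+-identityʳ (ind b))

  ind-∧-false : ∀ a → ind (a ∧ false) ≡ 0
  ind-∧-false a = cong ind (∧-zeroʳ a)

  ind-∧-mono : ∀ a {P Q : Set} (p : Dec P) (q : Dec Q) → (P → Q) →
               ind (a ∧ ⌊ p ⌋) ≤ ind (a ∧ ⌊ q ⌋)
  ind-∧-mono false p q P→Q = z≤n
  ind-∧-mono true (no _) q P→Q = z≤n
  ind-∧-mono true (yes p) q P→Q rewrite ⌊⌋-yes q (P→Q p) = ≤-refl

  sum-select : ∀ {r} k → k < r → (g : ℕ → ℕ) →
               sumFin {r} (λ i → ind ⌊ k ℕ.≟ toℕ i ⌋ * g (toℕ i)) ≡ g k
  sum-select k k<r g = trans
    (sum-point _ (fromℕ< k<r) λ i i≢k → cong (λ b → ind b * g (toℕ i))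
       (⌊⌋-no (k ℕ.≟ toℕ i) λ k≡i → i≢k (toℕ-injective (trans (sym k≡i) (sym (toℕ-fromℕ< k<r))))))
    (trans (cong (λ b → ind b * g (toℕ (fromℕ< k<r))) (⌊⌋-yes (k ℕ.≟ _) (sym (toℕ-fromℕ< k<r))))
           (trans (+-identityʳ _) (cong g (toℕ-fromℕ< k<r))))

  sum-select₂ : ∀ {r} p q → p < r → q < r → (W : ℕ → ℕ → ℕ) →
    sumFin {r} (λ i → sumFin {r} (λ j → W (toℕ i) (toℕ j) * ind (⌊ p ℕ.≟ toℕ i ⌋ ∧ ⌊ q ℕ.≟ toℕ j ⌋)))
      ≡ W p q
  sum-select₂ {r} p q p<r q<r W = begin
    sumFin {r} (λ i → sumFin {r} (λ j → W (toℕ i) (toℕ j) * ind (⌊ p ℕ.≟ toℕ i ⌋ ∧ ⌊ q ℕ.≟ toℕ j ⌋)))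
      ≡⟨ sum-cong {r} (λ i → trans (sum-cong {r} (λ j → regroup (W (toℕ i) (toℕ j)) ⌊ p ℕ.≟ toℕ i ⌋ ⌊ q ℕ.≟ toℕ j ⌋))
                               (sum-*ˡ (ind ⌊ p ℕ.≟ toℕ i ⌋) (λ (j : Fin r) → ind ⌊ q ℕ.≟ toℕ j ⌋ * W (toℕ i) (toℕ j)))) ⟩
    sumFin {r} (λ i → ind ⌊ p ℕ.≟ toℕ i ⌋ * sumFin {r} (λ (j : Fin r) → ind ⌊ q ℕ.≟ toℕ j ⌋ * W (toℕ i) (toℕ j)))
      ≡⟨ sum-cong {r} (λ i → cong (ind ⌊ p ℕ.≟ toℕ i ⌋ *_) (sum-select q q<r (W (toℕ i)))) ⟩
    sumFin {r} (λ i → ind ⌊ p ℕ.≟ toℕ i ⌋ * W (toℕ i) q)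
      ≡⟨ sum-select p p<r (λ i → W i q) ⟩
    W p q ∎
    where
    open ≡-Reasoning
    regroup : ∀ w a b → w * ind (a ∧ b) ≡ ind a * (ind b * w)
    regroup w a b = trans (cong (w *_) (ind-∧ a b))
                          (trans (*-comm w (ind a * ind b)) (*-assoc (ind a) (ind b) w))

  le lt eq : ℕ → ℕ → ℕ
  le x y = ind ⌊ x ℕ.≤? y ⌋
  lt x y = ind ⌊ x ℕ.<? y ⌋
  eq x y = ind ⌊ x ℕ.≟ y ⌋

  le≡lt+eq : ∀ x y → le x y ≡ lt x y + eq x y
  le≡lt+eq x y with <-cmp x y
  ... | tri< x<y x≢y _ rewrite ⌊⌋-yes (x ℕ.≤? y) (<⇒≤ x<y) | ⌊⌋-yes (x ℕ.<? y) x<y | ⌊⌋-no (x ℕ.≟ y) x≢y = refl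
  ... | tri≈ x≮y x≡y _ rewrite ⌊⌋-yes (x ℕ.≤? y) (≤-reflexive x≡y) | ⌊⌋-no (x ℕ.<? y) x≮y | ⌊⌋-yes (x ℕ.≟ y) x≡y = refl
  ... | tri> x≮y x≢y y<x rewrite ⌊⌋-no (x ℕ.≤? y) (<⇒≱ y<x) | ⌊⌋-no (x ℕ.<? y) x≮y | ⌊⌋-no (x ℕ.≟ y) x≢y = refl

  le+lt≡1 : ∀ x y → le x y + lt y x ≡ 1
  le+lt≡1 x y with ≤-<-connex x y
  ... | inj₁ x≤y rewrite ⌊⌋-yes (x ℕ.≤? y) x≤y | ⌊⌋-no (y ℕ.<? x) (≤⇒≯ x≤y) = refl
  ... | inj₂ y<x rewrite ⌊⌋-no (x ℕ.≤? y) (<⇒≱ y<x) | ⌊⌋-yes (y ℕ.<? x) y<x = refl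

  lt+lt≤1 : ∀ x y → lt x y + lt y x ≤ 1
  lt+lt≤1 x y with x ℕ.<? y
  ... | yes x<y rewrite ⌊⌋-no (y ℕ.<? x) (<⇒≯ x<y) = ≤-refl
  ... | no _ = ind≤1 ⌊ y ℕ.<? x ⌋
    where ind≤1 : ∀ b → ind b ≤ 1
          ind≤1 true = ≤-refl
          ind≤1 false = z≤n


module Ranks where

  open FiniteSums
  open import Defs
  open import Data.Bool using (Bool; true; false; _∧_)
  open import Data.Bool.Properties using (∧-identityʳ)
  open import Data.Nat as ℕ using (ℕ; zero; suc; _+_; _*_; _≤_; _<_; z≤n; s≤s; s≤s⁻¹; _⊓_; _/_; _%_; NonZero)
  open import Data.Product using (_×_; _,_; proj₁; proj₂)
  open import Data.Nat.Properties
  open import Data.Nat.DivMod using (m≡m%n+[m/n]*n; m%n<n; m/n*n≤m; m*n/n≡m; /-monoˡ-≤; m<n*o⇒m/o<n)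
  open import Data.Fin as F using (Fin; zero; suc)
  open import Data.Fin.Subset using (Subset; ∣_∣)
  open import Data.Vec using ([]; _∷_; lookup)
  open import Relation.Binary.PropositionalEquality
  open import Relation.Nullary using (yes; no)
  open import Relation.Nullary.Decidable using (⌊_⌋)

  rank-zero : ∀ {n} (Z : Subset (suc n)) → rankIn Z zero ≡ 0
  rank-zero {n} Z = sum-zero λ k →
    trans (cong (λ b → ind (lookup Z k ∧ b)) (⌊⌋-no (k F.<? zero {n}) λ ()))
          (ind-∧-false (lookup Z k))

  rank-suc : ∀ {n} (z : Bool) (Z : Subset n) x → rankIn (z ∷ Z) (suc x) ≡ ind z + rankIn Z x
  rank-suc z Z x = cong₂ _+_ (cong ind (∧-identityʳ z))
    (sum-cong λ k → cong (λ b → ind (lookup Z k ∧ b))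
                         (⌊⌋-cong (suc k F.<? suc x) (k F.<? x) s≤s⁻¹ s≤s))

  card-∷ : ∀ {n} z (Z : Subset n) → ∣ z ∷ Z ∣ ≡ ind z + ∣ Z ∣
  card-∷ true Z = refl
  card-∷ false Z = refl

  rank-mono : ∀ {n} (Z : Subset n) {x y : Fin n} → x F.≤ y → rankIn Z x ≤ rankIn Z y
  rank-mono Z x≤y = sum-mono λ k →
    ind-∧-mono (lookup Z k) (k F.<? _) (k F.<? _) (λ k<x → <-≤-trans k<x x≤y)

  rank<card : ∀ {n} (Z : Subset n) x → lookup Z x ≡ true → rankIn Z x < ∣ Z ∣
  rank<card (false ∷ Z) zero ()
  rank<card (true ∷ Z) zero _ rewrite rank-zero (true ∷ Z) = s≤s z≤n
  rank<card (z ∷ Z) (suc x) x∈Z rewrite rank-suc z Z x | card-∷ z Z =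
    +-monoʳ-< (ind z) (rank<card Z x x∈Z)

  count-rank< : ∀ {n} (Z : Subset n) (b : ℕ) →
                sumFin (λ x → ind (lookup Z x ∧ ⌊ rankIn Z x ℕ.<? b ⌋)) ≡ b ⊓ ∣ Z ∣
  count-rank< [] b = sym (⊓-zeroʳ b)
  count-rank< (false ∷ Z) b = trans
    (sum-cong λ x → cong (λ t → ind (lookup Z x ∧ ⌊ t ℕ.<? b ⌋)) (rank-suc false Z x))
    (count-rank< Z b)
  count-rank< (true ∷ Z) zero = sum-zero λ x → trans
    (cong (λ b → ind (lookup (true ∷ Z) x ∧ b)) (⌊⌋-no (rankIn (true ∷ Z) x ℕ.<? 0) λ ()))
    (ind-∧-false (lookup (true ∷ Z) x))
  count-rank< (true ∷ Z) (suc b) = cong₂ _+_ first rest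
    where
    first : ind ⌊ rankIn (true ∷ Z) zero ℕ.<? suc b ⌋ ≡ 1
    first = cong ind (⌊⌋-yes (_ ℕ.<? suc b) (subst (_< suc b) (sym (rank-zero (true ∷ Z))) (s≤s z≤n)))
    rest : sumFin (λ x → ind (lookup Z x ∧ ⌊ rankIn (true ∷ Z) (suc x) ℕ.<? suc b ⌋)) ≡ b ⊓ ∣ Z ∣
    rest = trans (sum-cong λ x → cong (λ t → ind (lookup Z x ∧ t))
                    (trans (cong (λ t → ⌊ t ℕ.<? suc b ⌋) (rank-suc true Z x))
                           (⌊⌋-cong (_ ℕ.<? suc b) (_ ℕ.<? b) s≤s⁻¹ s≤s)))
                 (count-rank< Z b)

  quotient-char : ∀ {k j m} .{{_ : NonZero m}} → j * m ≤ k → k < suc j * m → k / m ≡ j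
  quotient-char {k} {j} {m} lo hi = ≤-antisym
    (s≤s⁻¹ (m<n*o⇒m/o<n {k} {suc j} {m} hi))
    (subst (_≤ k / m) (m*n/n≡m j m) (/-monoˡ-≤ m lo))

  quotient-bounds : ∀ k m .{{_ : NonZero m}} → k / m * m ≤ k × k < suc (k / m) * m
  quotient-bounds k m = m/n*n≤m k m , (begin-strict
    k                       ≡⟨ m≡m%n+[m/n]*n k m ⟩
    k % m + k / m * m       <⟨ +-monoˡ-< (k / m * m) (m%n<n k m) ⟩
    m + k / m * m           ∎)
    where open ≤-Reasoning

  module Blocks {n} (Z : Subset n) (m : ℕ) .{{_ : NonZero m}} where

    block : Fin n → ℕ
    block x = rankIn Z x / m

    block-mono : ∀ {x y} → x F.≤ y → block x ≤ block y
    block-mono x≤y = /-monoˡ-≤ m (rank-mono Z x≤y)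

    block< : ∀ {r} x → ∣ Z ∣ ≡ r * m → lookup Z x ≡ true → block x < r
    block< {r} x |Z| x∈Z = m<n*o⇒m/o<n {rankIn Z x} {r} {m} (subst (rankIn Z x <_) |Z| (rank<card Z x x∈Z))

    inInterval≡block : ∀ j x → lookup Z x ≡ true → inInterval Z m j x ≡ ⌊ block x ℕ.≟ j ⌋
    inInterval≡block j x x∈Z rewrite x∈Z with block x ℕ.≟ j
    ... | yes refl = cong₂ _∧_ (⌊⌋-yes (_ ℕ.≤? _) (proj₁ (quotient-bounds (rankIn Z x) m)))
                               (⌊⌋-yes (_ ℕ.<? _) (proj₂ (quotient-bounds (rankIn Z x) m)))
    ... | no block≢j with j * m ℕ.≤? rankIn Z x
    ...   | no _ = refl
    ...   | yes lo = ⌊⌋-no (_ ℕ.<? _) (λ hi → block≢j (quotient-char lo hi))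

    interval-size : ∀ j → suc j * m ≤ ∣ Z ∣ → sumFin (λ x → ind (inInterval Z m j x)) ≡ m
    interval-size j fits = +-cancelˡ-≡ (j * m) _ _ (begin
        j * m + inside                                 ≡⟨ cong (_+ inside) (below≡ (j * m) (≤-trans (m≤n+m (j * m) m) fits)) ⟨
        below (j * m) + inside                         ≡⟨ sum-+ (below-term (j * m)) (λ x → ind (inInterval Z m j x)) ⟨
        sumFin (λ x → below-term (j * m) x + ind (inInterval Z m j x)) ≡⟨ sum-cong split ⟩
        below (suc j * m)                              ≡⟨ below≡ (suc j * m) fits ⟩
        suc j * m                                      ≡⟨ +-comm m (j * m) ⟩
        j * m + m                                      ∎)
      where
      open ≡-Reasoning
      inside : ℕ
      inside = sumFin (λ x → ind (inInterval Z m j x))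
      below-term : ℕ → Fin n → ℕ
      below-term b x = ind (lookup Z x ∧ ⌊ rankIn Z x ℕ.<? b ⌋)
      below : ℕ → ℕ
      below b = sumFin (below-term b)
      below≡ : ∀ b → b ≤ ∣ Z ∣ → below b ≡ b
      below≡ b b≤|Z| = trans (count-rank< Z b) (m≤n⇒m⊓n≡m b≤|Z|)
      split : ∀ x → below-term (j * m) x + ind (inInterval Z m j x) ≡ below-term (suc j * m) x
      split x with lookup Z x
      ... | false = refl
      ... | true with rankIn Z x ℕ.<? j * m
      ...   | yes lt rewrite ⌊⌋-no (j * m ℕ.≤? rankIn Z x) (<⇒≱ lt)
                           | ⌊⌋-yes (rankIn Z x ℕ.<? suc j * m) (<-≤-trans lt (m≤n+m (j * m) m)) = refl
      ...   | no ≮ rewrite ⌊⌋-yes (j * m ℕ.≤? rankIn Z x) (≮⇒≥ ≮) = refl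


module SubsetSums where

  open FiniteSums
  open import Defs
  open import Data.Bool using (true; false; _∧_; _∨_)
  open import Data.Bool.Properties using (∧-identityʳ)
  open import Data.Nat using (ℕ; _+_; _*_)
  open import Data.Fin as F using (Fin)
  open import Data.Fin.Subset using (Subset; ∣_∣; _∈_; _∪_)
  open import Data.Vec using (lookup)
  open import Data.Vec.Properties using (lookup-zipWith; []=⇒lookup; lookup⇒[]=)
  open import Data.Product using (Σ-syntax; _×_; _,_)
  open import Data.Empty using (⊥; ⊥-elim)
  open import Function using (case_of_)
  open import Relation.Binary.PropositionalEquality
  open import Relation.Nullary using (yes; no)
  open import Relation.Nullary.Decidable using (⌊_⌋)

  ∈⇒true : ∀ {n} {p : Subset n} {x} → x ∈ p → lookup p x ≡ true
  ∈⇒true = []=⇒lookup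

  true⇒∈ : ∀ {n} {p : Subset n} {x} → lookup p x ≡ true → x ∈ p
  true⇒∈ {p = p} {x} = lookup⇒[]= x p

  lookup-∪ : ∀ {n} (p q : Subset n) x → lookup (p ∪ q) x ≡ lookup p x ∨ lookup q x
  lookup-∪ p q x = lookup-zipWith _∨_ x p q

  ind-∪ : ∀ {n} (p q : Subset n) → Disjoint p q → ∀ x →
          ind (lookup (p ∪ q) x) ≡ ind (lookup p x) + ind (lookup q x)
  ind-∪ p q p∩q=∅ x rewrite lookup-∪ p q x with lookup p x in x∈p | lookup q x in x∈q
  ... | false | _ = refl
  ... | true | false = refl
  ... | true | true = ⊥-elim (p∩q=∅ x (true⇒∈ x∈p) (true⇒∈ x∈q))

  card-∪ : ∀ {n} (p q : Subset n) → Disjoint p q → ∣ p ∪ q ∣ ≡ ∣ p ∣ + ∣ q ∣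
  card-∪ p q p∩q=∅ = begin
    ∣ p ∪ q ∣                                                  ≡⟨ card≡sum (p ∪ q) ⟩
    sumFin (λ x → ind (lookup (p ∪ q) x))                      ≡⟨ sum-cong (ind-∪ p q p∩q=∅) ⟩
    sumFin (λ x → ind (lookup p x) + ind (lookup q x))         ≡⟨ sum-+ (λ x → ind (lookup p x)) (λ x → ind (lookup q x)) ⟩
    sumFin (λ x → ind (lookup p x)) + sumFin (λ x → ind (lookup q x))
                                                               ≡⟨ cong₂ _+_ (card≡sum p) (card≡sum q) ⟨
    ∣ p ∣ + ∣ q ∣                                              ∎
    where open ≡-Reasoning

  -- Reindexing a sum along a bijection τ from A onto B: both sides equal the
  -- double sum of f x over the pairs (u , x) with u ∈ A and τ u ≡ x.
  sum-bijection : ∀ {n} (A B : Subset n) (τ : Fin n → Fin n) →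
    (∀ u → u ∈ A → τ u ∈ B) →
    (∀ u v → u ∈ A → v ∈ A → τ u ≡ τ v → u ≡ v) →
    (∀ x → x ∈ B → Σ[ u ∈ Fin n ] (u ∈ A × τ u ≡ x)) →
    (f : Fin n → ℕ) →
    sumFin (λ u → ind (lookup A u) * f (τ u)) ≡ sumFin (λ x → ind (lookup B x) * f x)
  sum-bijection {n} A B τ into injective onto f = begin
    sumFin (λ u → ind (lookup A u) * f (τ u))     ≡⟨ sum-cong by-u ⟨
    sumFin (λ u → sumFin (λ x → pair u x))         ≡⟨ sum-swap pair ⟩
    sumFin (λ x → sumFin (λ u → pair u x))         ≡⟨ sum-cong by-x ⟩
    sumFin (λ x → ind (lookup B x) * f x)          ∎
    where
    open ≡-Reasoning
    pair : Fin n → Fin n → ℕ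
    pair u x = ind (lookup A u ∧ ⌊ τ u F.≟ x ⌋) * f x

    pair-vanish : ∀ u x → (u ∈ A → τ u ≡ x → ⊥) → pair u x ≡ 0
    pair-vanish u x not-pair with lookup A u in u∈A | τ u F.≟ x
    ... | false | _ = refl
    ... | true | no _ = refl
    ... | true | yes τu≡x = ⊥-elim (not-pair (true⇒∈ u∈A) τu≡x)

    pair-on : ∀ u x → τ u ≡ x → pair u x ≡ ind (lookup A u) * f x
    pair-on u x τu≡x rewrite ⌊⌋-yes (τ u F.≟ x) τu≡x | ∧-identityʳ (lookup A u) = refl

    by-u : ∀ u → sumFin (λ x → pair u x) ≡ ind (lookup A u) * f (τ u)
    by-u u = trans (sum-point (pair u) (τ u) (λ x x≢τu → pair-vanish u x (λ _ τu≡x → x≢τu (sym τu≡x))))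
                   (pair-on u (τ u) refl)

    by-x : ∀ x → sumFin (λ u → pair u x) ≡ ind (lookup B x) * f x
    by-x x with lookup B x in x∈B
    ... | true = let (u₀ , u₀∈A , τu₀≡x) = onto x (true⇒∈ x∈B) in
      trans (sum-point (λ u → pair u x) u₀
               (λ u u≢u₀ → pair-vanish u x (λ u∈A τu≡x →
                  u≢u₀ (injective u u₀ u∈A u₀∈A (trans τu≡x (sym τu₀≡x))))))
            (trans (pair-on u₀ x τu₀≡x) (cong (λ b → ind b * f x) (∈⇒true u₀∈A)))
    ... | false = sum-zero λ u → pair-vanish u x λ u∈A τu≡x →
      case trans (sym (∈⇒true (subst (_∈ B) τu≡x (into u u∈A)))) x∈B of λ ()


module BlockPartition where

  open FiniteSums
  open Ranks
  open SubsetSums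
  open import Defs
  open import Data.Bool using (Bool; true; false; _∧_)
  open import Data.Bool.Properties using (∧-identityʳ; ∧-zeroʳ)
  open import Data.Nat as ℕ using (ℕ; suc; _+_; _*_; _≤_; _<_; z≤n; NonZero)
  open import Data.Nat.Properties
  open import Data.Fin as F using (Fin; toℕ)
  open import Data.Fin.Properties using (toℕ<n)
  open import Data.Fin.Subset using (Subset; ∣_∣; _∈_; _∪_; _⊆_)
  open import Data.Fin.Subset.Properties using (p⊆p∪q; q⊆p∪q)
  open import Data.Vec using (lookup; tabulate)
  open import Data.Vec.Properties using (lookup∘tabulate)
  open import Data.Product using (Σ-syntax; _×_; _,_; proj₁; proj₂)
  open import Relation.Binary.PropositionalEquality hiding (J)
  open import Relation.Nullary.Decidable using (⌊_⌋)

  forward backward : ∀ {n} → (Fin n → Fin n) → Arcs n → ℕ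
  forward τ D = sumFin (λ u → sumFin (λ v → ind (D u v ∧ ⌊ τ u F.<? τ v ⌋)))
  backward τ D = sumFin (λ u → sumFin (λ v → ind (D u v ∧ ⌊ τ v F.<? τ u ⌋)))

  arcCount≤ : ∀ {n} (D : Arcs n) (L' R' : Subset n) → arcCount D L' R' ≤ ∣ L' ∣ * ∣ R' ∣
  arcCount≤ D L' R' = begin
    arcCount D L' R'                                                 ≤⟨ sum-mono (λ u → sum-mono (λ v → pointwise u v)) ⟩
    sumFin (λ u → sumFin (λ v → ind (lookup L' u) * ind (lookup R' v)))
      ≡⟨ sum-cong (λ u → sum-*ˡ (ind (lookup L' u)) (λ v → ind (lookup R' v))) ⟩
    sumFin (λ u → ind (lookup L' u) * sumFin (λ v → ind (lookup R' v)))
      ≡⟨ sum-*ʳ _ (λ u → ind (lookup L' u)) ⟩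
    sumFin (λ u → ind (lookup L' u)) * sumFin (λ v → ind (lookup R' v))
      ≡⟨ cong₂ _*_ (card≡sum L') (card≡sum R') ⟨
    ∣ L' ∣ * ∣ R' ∣                                                   ∎
    where
    open ≤-Reasoning
    pointwise : ∀ u v → ind (lookup L' u ∧ lookup R' v ∧ D u v) ≤ ind (lookup L' u) * ind (lookup R' v)
    pointwise u v with lookup L' u | lookup R' v | D u v
    ... | true | true | true = ≤-refl
    ... | true | true | false = z≤n
    ... | true | false | _ = z≤n
    ... | false | _ | _ = z≤n

  module Decomposition {n} (L R X Y : Subset n) (D : Arcs n) (τ : Fin n → Fin n)
    (r m : ℕ) .{{_ : NonZero m}} (adm : IsAdmissible L R X Y τ)
    (L∩R=∅ : Disjoint L R) (D⊆L×R : ArcsIn D L R) (|X∪Y| : ∣ X ∪ Y ∣ ≡ r * m) where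

    Z : Subset n
    Z = X ∪ Y

    open Blocks Z m

    τ-into : ∀ u → u ∈ L ∪ R → τ u ∈ Z
    τ-into = proj₁ adm

    τ-injective : ∀ u v → u ∈ L ∪ R → v ∈ L ∪ R → τ u ≡ τ v → u ≡ v
    τ-injective = proj₁ (proj₂ adm)

    τ-onto : ∀ x → x ∈ Z → Σ[ u ∈ Fin n ] (u ∈ L ∪ R × τ u ≡ x)
    τ-onto = proj₁ (proj₂ (proj₂ adm))

    τ-L⊆X : ∀ u → u ∈ L → τ u ∈ X
    τ-L⊆X = proj₁ (proj₂ (proj₂ (proj₂ adm)))

    τ-onto-X : ∀ x → x ∈ X → Σ[ u ∈ Fin n ] (u ∈ L × τ u ≡ x)
    τ-onto-X = proj₂ (proj₂ (proj₂ (proj₂ adm)))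

    L⊆L∪R : ∀ {u} → u ∈ L → u ∈ L ∪ R
    L⊆L∪R = p⊆p∪q R

    R⊆L∪R : ∀ {u} → u ∈ R → u ∈ L ∪ R
    R⊆L∪R = q⊆p∪q L R

    β : Fin n → ℕ
    β u = block (τ u)

    β< : ∀ u → u ∈ L ∪ R → β u < r
    β< u u∈L∪R = block< (τ u) |X∪Y| (∈⇒true (τ-into u u∈L∪R))

    inPart : ℕ → Fin n → Bool
    inPart j u = inInterval Z m j (τ u)

    inPart≡β : ∀ j u → u ∈ L ∪ R → inPart j u ≡ ⌊ β u ℕ.≟ j ⌋
    inPart≡β j u u∈L∪R = inInterval≡block j (τ u) (∈⇒true (τ-into u u∈L∪R))

    part : Subset n → Fin r → Subset n
    part S i = tabulate (λ u → lookup S u ∧ inPart (toℕ i) u)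

    lookup-part : ∀ S i u → lookup (part S i) u ≡ lookup S u ∧ inPart (toℕ i) u
    lookup-part S i u = lookup∘tabulate _ u

    part⊆ : ∀ S i → part S i ⊆ S
    part⊆ S i {u} u∈Si = true⇒∈ (∧-true (trans (sym (lookup-part S i u)) (∈⇒true u∈Si)))
      where ∧-true : ∀ {a b} → a ∧ b ≡ true → a ≡ true
            ∧-true {true} _ = refl

    card-part : ∀ S i → ∣ part S i ∣ ≡ sumFin (λ u → ind (lookup S u) * ind (inPart (toℕ i) u))
    card-part S i = trans (card≡sum (part S i))
      (sum-cong λ u → trans (cong ind (lookup-part S i u)) (ind-∧ (lookup S u) _))

    -- |L_i| = |X ∩ I_i|, since τ maps L bijectively onto X
    card-Lpart : ∀ i → ∣ part L i ∣ ≡ countInInterval X Z m (toℕ i)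
    card-Lpart i = begin
      ∣ part L i ∣                                                       ≡⟨ card-part L i ⟩
      sumFin (λ u → ind (lookup L u) * ind (inPart (toℕ i) u))
        ≡⟨ sum-bijection L X τ τ-L⊆X
             (λ u v u∈L v∈L → τ-injective u v (L⊆L∪R u∈L) (L⊆L∪R v∈L))
             τ-onto-X (λ x → ind (inInterval Z m (toℕ i) x)) ⟩
      sumFin (λ x → ind (lookup X x) * ind (inInterval Z m (toℕ i) x))
        ≡⟨ sum-cong (λ x → sym (ind-∧ (lookup X x) _)) ⟩
      countInInterval X Z m (toℕ i)                                       ∎
      where open ≡-Reasoning

    -- |L_i| + |R_i| = |I_i| = m, since τ maps L ∪ R bijectively onto X ∪ Y
    part-size : ∀ i → ∣ part L i ∣ + ∣ part R i ∣ ≡ m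
    part-size i = begin
      ∣ part L i ∣ + ∣ part R i ∣                        ≡⟨ cong₂ _+_ (card-part L i) (card-part R i) ⟩
      sumFin (λ u → ind (lookup L u) * J u) + sumFin (λ u → ind (lookup R u) * J u)
        ≡⟨ sum-+ (λ u → ind (lookup L u) * J u) (λ u → ind (lookup R u) * J u) ⟨
      sumFin (λ u → ind (lookup L u) * J u + ind (lookup R u) * J u)
        ≡⟨ sum-cong (λ u → trans (sym (*-distribʳ-+ (J u) (ind (lookup L u)) (ind (lookup R u)))) (cong (_* J u) (sym (ind-∪ L R L∩R=∅ u)))) ⟩
      sumFin (λ u → ind (lookup (L ∪ R) u) * J u)
        ≡⟨ sum-bijection (L ∪ R) Z τ τ-into τ-injective τ-onto I ⟩
      sumFin (λ x → ind (lookup Z x) * I x)               ≡⟨ sum-cong I⊆Z ⟩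
      sumFin I                                            ≡⟨ interval-size (toℕ i) fits ⟩
      m                                                   ∎
      where
      open ≡-Reasoning
      I : Fin n → ℕ
      I x = ind (inInterval Z m (toℕ i) x)
      J : Fin n → ℕ
      J u = I (τ u)
      I⊆Z : ∀ x → ind (lookup Z x) * I x ≡ I x
      I⊆Z x with lookup Z x
      ... | true = +-identityʳ _
      ... | false = refl
      fits : suc (toℕ i) * m ≤ ∣ Z ∣
      fits = subst (suc (toℕ i) * m ≤_) (sym |X∪Y|) (*-monoˡ-≤ m (toℕ<n i))

    one-part : ∀ u → u ∈ L ∪ R → sumFin {r} (λ i → ind (inPart (toℕ i) u)) ≡ 1
    one-part u u∈L∪R = trans
      (sum-cong {r} λ i → trans (cong ind (inPart≡β (toℕ i) u u∈L∪R)) (sym (*-identityʳ _)))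
      (sum-select (β u) (β< u u∈L∪R) (λ _ → 1))

    parts-cover : ∀ S → S ⊆ L ∪ R → sumFin (λ i → ∣ part S i ∣) ≡ ∣ S ∣
    parts-cover S S⊆L∪R = begin
      sumFin (λ i → ∣ part S i ∣)
        ≡⟨ sum-cong (card-part S) ⟩
      sumFin (λ (i : Fin r) → sumFin (λ u → ind (lookup S u) * ind (inPart (toℕ i) u)))
        ≡⟨ sum-swap (λ (i : Fin r) u → ind (lookup S u) * ind (inPart (toℕ i) u)) ⟩
      sumFin (λ u → sumFin (λ (i : Fin r) → ind (lookup S u) * ind (inPart (toℕ i) u)))
        ≡⟨ sum-cong (λ u → sum-*ˡ (ind (lookup S u)) (λ (i : Fin r) → ind (inPart (toℕ i) u))) ⟩
      sumFin (λ u → ind (lookup S u) * sumFin (λ (i : Fin r) → ind (inPart (toℕ i) u)))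
        ≡⟨ sum-cong in-one-part ⟩
      sumFin (λ u → ind (lookup S u))                    ≡⟨ card≡sum S ⟨
      ∣ S ∣                                              ∎
      where
      open ≡-Reasoning
      in-one-part : ∀ u → ind (lookup S u) * sumFin (λ (i : Fin r) → ind (inPart (toℕ i) u)) ≡ ind (lookup S u)
      in-one-part u with lookup S u in u∈S
      ... | false = refl
      ... | true = trans (+-identityʳ _) (one-part u (S⊆L∪R (true⇒∈ u∈S)))

    arc-in-parts : ∀ i j u v → lookup (part L i) u ∧ lookup (part R j) v ∧ D u v
                               ≡ D u v ∧ ⌊ β u ℕ.≟ toℕ i ⌋ ∧ ⌊ β v ℕ.≟ toℕ j ⌋
    arc-in-parts i j u v with D u v in uv∈D
    ... | false rewrite ∧-zeroʳ (lookup (part R j) v) = ∧-zeroʳ (lookup (part L i) u)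
    ... | true with D⊆L×R u v uv∈D
    ...   | u∈L , v∈R rewrite lookup-part L i u | lookup-part R j v
                            | ∈⇒true u∈L | ∈⇒true v∈R
                            | inPart≡β (toℕ i) u (L⊆L∪R u∈L) | inPart≡β (toℕ j) v (R⊆L∪R v∈R) =
      cong (⌊ β u ℕ.≟ toℕ i ⌋ ∧_) (∧-identityʳ _)

    block-sum : (W : ℕ → ℕ → ℕ) →
      sumFin (λ (i : Fin r) → sumFin (λ (j : Fin r) → W (toℕ i) (toℕ j) * arcCount D (part L i) (part R j)))
        ≡ sumFin (λ u → sumFin (λ v → ind (D u v) * W (β u) (β v)))
    block-sum W = begin
      sumFin (λ (i : Fin r) → sumFin (λ (j : Fin r) → W (toℕ i) (toℕ j) * arcCount D (part L i) (part R j)))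
        ≡⟨ sum-cong {r} (λ i → sum-cong {r} (λ j → weight-inside (W (toℕ i) (toℕ j)) (part L i) (part R j))) ⟩
      sumFin (λ (i : Fin r) → sumFin (λ (j : Fin r) → sumFin (λ u → sumFin (λ v → term i j u v))))
        ≡⟨ sum-swap-pairs term ⟩
      sumFin (λ u → sumFin (λ v → sumFin (λ (i : Fin r) → sumFin (λ (j : Fin r) → term i j u v))))
        ≡⟨ sum-cong (λ u → sum-cong (λ v → arc-weight u v)) ⟩
      sumFin (λ u → sumFin (λ v → ind (D u v) * W (β u) (β v))) ∎
      where
      open ≡-Reasoning
      term : Fin r → Fin r → Fin n → Fin n → ℕ
      term i j u v = W (toℕ i) (toℕ j) * ind (lookup (part L i) u ∧ lookup (part R j) v ∧ D u v)

      weight-inside : ∀ w L' R' → w * arcCount D L' R'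
                      ≡ sumFin (λ u → sumFin (λ v → w * ind (lookup L' u ∧ lookup R' v ∧ D u v)))
      weight-inside w L' R' = sym (trans (sum-cong (λ u → sum-*ˡ w (λ v → arc u v)))
                                         (sum-*ˡ w (λ u → sumFin (λ v → arc u v))))
        where arc : Fin n → Fin n → ℕ
              arc u v = ind (lookup L' u ∧ lookup R' v ∧ D u v)

      by-arc : ∀ u v →
        sumFin (λ (i : Fin r) → sumFin (λ (j : Fin r) →
          W (toℕ i) (toℕ j) * ind (D u v ∧ ⌊ β u ℕ.≟ toℕ i ⌋ ∧ ⌊ β v ℕ.≟ toℕ j ⌋)))
        ≡ ind (D u v) * W (β u) (β v)
      by-arc u v with D u v in uv∈D
      ... | false = sum-zero {r} (λ i → sum-zero {r} (λ j → *-zeroʳ (W (toℕ i) (toℕ j))))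
      ... | true with D⊆L×R u v uv∈D
      ...   | u∈L , v∈R = trans (sum-select₂ (β u) (β v) (β< u (L⊆L∪R u∈L)) (β< v (R⊆L∪R v∈R)) W)
                                (sym (+-identityʳ _))

      arc-weight : ∀ u v → sumFin (λ (i : Fin r) → sumFin (λ (j : Fin r) → term i j u v))
                           ≡ ind (D u v) * W (β u) (β v)
      arc-weight u v = trans
        (sum-cong {r} (λ i → sum-cong {r} (λ j → cong (λ b → W (toℕ i) (toℕ j) * ind b) (arc-in-parts i j u v))))
        (by-arc u v)

    -- an arc oriented forwards by τ joins parts L_i and R_j with i ≤ j
    forward≤ : forward τ D ≤ sumFin (λ (i : Fin r) → sumFin (λ (j : Fin r) →
                               le (toℕ i) (toℕ j) * arcCount D (part L i) (part R j)))
    forward≤ = ≤-trans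
      (sum-mono λ u → sum-mono λ v → ≤-trans
        (ind-∧-mono (D u v) (τ u F.<? τ v) (β u ℕ.≤? β v) (λ τu<τv → block-mono (<⇒≤ τu<τv)))
        (≤-reflexive (ind-∧ (D u v) _)))
      (≤-reflexive (sym (block-sum le)))

    -- an arc joining parts L_i and R_j with i > j is oriented backwards by τ
    backward≥ : sumFin (λ (i : Fin r) → sumFin (λ (j : Fin r) →
                  lt (toℕ j) (toℕ i) * arcCount D (part L i) (part R j))) ≤ backward τ D
    backward≥ = ≤-trans
      (≤-reflexive (block-sum (λ x y → lt y x)))
      (sum-mono λ u → sum-mono λ v → ≤-trans
        (≤-reflexive (sym (ind-∧ (D u v) _)))
        (ind-∧-mono (D u v) (β v ℕ.<? β u) (τ v F.<? τ u)
           (λ βv<βu → ≰⇒> (λ τu≤τv → <⇒≱ βv<βu (block-mono τu≤τv)))))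


module BlockArithmetic where

  open FiniteSums
  open import Defs
  open import Data.Nat as ℕ using (ℕ; suc; _+_; _*_; _≤_; _<_; z≤n; s≤s; >-nonZero)
  open import Data.Nat.Properties
  open import Data.Nat.Solver using (module +-*-Solver)
  open +-*-Solver using (solve; _:+_; _:*_; con; _:=_)
  open import Data.Fin using (Fin; toℕ)
  open import Data.Fin.Properties using (toℕ-injective)
  open import Relation.Binary.PropositionalEquality
  open import Relation.Nullary using (yes; no)
  open import Data.Product using (_×_; proj₁; proj₂)

  cancelˡ : ∀ c {x y} → 0 < c → c * x ≤ c * y → x ≤ y
  cancelˡ c c>0 = *-cancelˡ-≤ c {{>-nonZero c>0}}

  *-pos : ∀ {a b} → 0 < a → 0 < b → 0 < a * b
  *-pos {suc a} {suc b} _ _ = s≤s z≤n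

  -- The count x of an interval satisfies
  -- |r x - X| ≤ 25 P / (12 r l) with P ≤ X l; cancelling l gives the
  -- cruder |r x - X| ≤ 25 X / (12 r), from which x > X / (2r) for r ≥ 5 and
  -- x ≤ 13 X / (12 r) for r ≥ 25.
  cancel-l-lo : ∀ r l X x P → 0 < l → P ≤ X * l →
                12 * r * l * X ≤ 12 * r * l * (r * x) + 25 * P →
                12 * r * X ≤ 12 * r * (r * x) + 25 * X
  cancel-l-lo r l X x P l>0 P≤Xl lo = cancelˡ l l>0 (begin
    l * (12 * r * X)                     ≡⟨ solve 3 (λ l r X → l :* (con 12 :* r :* X) := con 12 :* r :* l :* X) refl l r X ⟩
    12 * r * l * X                       ≤⟨ lo ⟩
    12 * r * l * (r * x) + 25 * P        ≤⟨ +-monoʳ-≤ (12 * r * l * (r * x)) (*-monoʳ-≤ 25 P≤Xl) ⟩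
    12 * r * l * (r * x) + 25 * (X * l)  ≡⟨ solve 4 (λ l r X y → con 12 :* r :* l :* y :+ con 25 :* (X :* l) := l :* (con 12 :* r :* y :+ con 25 :* X)) refl l r X (r * x) ⟩
    l * (12 * r * (r * x) + 25 * X)      ∎)
    where open ≤-Reasoning

  cancel-l-hi : ∀ r l X x P → 0 < l → P ≤ X * l →
                12 * r * l * (r * x) ≤ 12 * r * l * X + 25 * P →
                12 * r * (r * x) ≤ 12 * r * X + 25 * X
  cancel-l-hi r l X x P l>0 P≤Xl hi = cancelˡ l l>0 (begin
    l * (12 * r * (r * x))               ≡⟨ solve 3 (λ l r y → l :* (con 12 :* r :* y) := con 12 :* r :* l :* y) refl l r (r * x) ⟩
    12 * r * l * (r * x)                 ≤⟨ hi ⟩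
    12 * r * l * X + 25 * P              ≤⟨ +-monoʳ-≤ (12 * r * l * X) (*-monoʳ-≤ 25 P≤Xl) ⟩
    12 * r * l * X + 25 * (X * l)        ≡⟨ solve 3 (λ l r X → con 12 :* r :* l :* X :+ con 25 :* (X :* l) := l :* (con 12 :* r :* X :+ con 25 :* X)) refl l r X ⟩
    l * (12 * r * X + 25 * X)            ∎)
    where open ≤-Reasoning

  more-than-half : ∀ r x X → 5 ≤ r → 0 < X →
                   12 * r * X ≤ 12 * r * (r * x) + 25 * X → X < 2 * r * x
  more-than-half r x X 5≤r X>0 lo = ≰⇒> λ 2rx≤X → <⇒≱ 50<12r (12r≤50 2rx≤X)
    where
    open ≤-Reasoning
    50<12r : 50 < 12 * r
    50<12r = ≤-trans (m≤n+m 51 9) (*-monoʳ-≤ 12 5≤r)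
    12r≤50 : 2 * r * x ≤ X → 12 * r ≤ 50
    12r≤50 2rx≤X = *-cancelʳ-≤ (12 * r) 50 X {{>-nonZero X>0}} (+-cancelˡ-≤ (12 * r * X) _ _ (begin
      12 * r * X + 12 * r * X            ≡⟨ solve 2 (λ r X → con 12 :* r :* X :+ con 12 :* r :* X := con 2 :* (con 12 :* r :* X)) refl r X ⟩
      2 * (12 * r * X)                   ≤⟨ *-monoʳ-≤ 2 lo ⟩
      2 * (12 * r * (r * x) + 25 * X)    ≡⟨ solve 3 (λ r x X → con 2 :* (con 12 :* r :* (r :* x) :+ con 25 :* X) := con 12 :* r :* (con 2 :* r :* x) :+ con 50 :* X) refl r x X ⟩
      12 * r * (2 * r * x) + 50 * X      ≤⟨ +-monoˡ-≤ (50 * X) (*-monoʳ-≤ (12 * r) 2rx≤X) ⟩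
      12 * r * X + 50 * X                ∎))

  at-most-13/12 : ∀ r x X → 25 ≤ r → 12 * r * (r * x) ≤ 12 * r * X + 25 * X → 12 * r * x ≤ 13 * X
  at-most-13/12 r x X 25≤r hi = cancelˡ r (≤-trans (s≤s z≤n) 25≤r) (begin
    r * (12 * r * x)                     ≡⟨ solve 2 (λ r x → r :* (con 12 :* r :* x) := con 12 :* r :* (r :* x)) refl r x ⟩
    12 * r * (r * x)                     ≤⟨ hi ⟩
    12 * r * X + 25 * X                  ≤⟨ +-monoʳ-≤ (12 * r * X) (*-monoˡ-≤ X 25≤r) ⟩
    12 * r * X + r * X                   ≡⟨ solve 2 (λ r X → con 12 :* r :* X :+ r :* X := r :* (con 13 :* X)) refl r X ⟩
    r * (13 * X)                         ∎)
    where open ≤-Reasoning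

  dsum : ∀ {r} → (Fin r → Fin r → ℕ) → ℕ
  dsum f = sumFin (λ i → sumFin (f i))

  dsum-mono : ∀ {r} {f g : Fin r → Fin r → ℕ} → (∀ i j → f i j ≤ g i j) → dsum f ≤ dsum g
  dsum-mono f≤g = sum-mono (λ i → sum-mono (f≤g i))

  dsum-cong : ∀ {r} {f g : Fin r → Fin r → ℕ} → (∀ i j → f i j ≡ g i j) → dsum f ≡ dsum g
  dsum-cong f≗g = sum-cong (λ i → sum-cong (f≗g i))

  dsum-+ : ∀ {r} (f g : Fin r → Fin r → ℕ) → dsum (λ i j → f i j + g i j) ≡ dsum f + dsum g
  dsum-+ f g = trans (sum-cong (λ i → sum-+ (f i) (g i))) (sum-+ (λ i → sumFin (f i)) (λ i → sumFin (g i)))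

  dsum-*ˡ : ∀ {r} c (f : Fin r → Fin r → ℕ) → dsum (λ i j → c * f i j) ≡ c * dsum f
  dsum-*ˡ c f = trans (sum-cong (λ i → sum-*ˡ c (f i))) (sum-*ˡ c (λ i → sumFin (f i)))

  dsum-const : ∀ {r} c → dsum {r} (λ _ _ → c) ≡ r * (r * c)
  dsum-const {r} c = trans (sum-cong {r} (λ _ → sum-const {r} c)) (sum-const {r} (r * c))

  -- There are r blocks; block i holds a i points of the
  -- left side and b i of the right side, a i + b i = m, and r a i is close to
  -- N = Σ a (so r b i is close to M = Σ b).  E i j counts arcs from the left
  -- points of block i to the right points of block j, and the regularity
  -- bounds say E i j / (a i b j) is within 1/(2r) of the overall density
  -- e / (N M).  Then the arcs going weakly forwards (U) exceed those going
  -- backwards (V) by less than 25 N M / (6 r).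
  module BlockEstimate (r m N M e : ℕ) (a b : Fin r → ℕ) (E : Fin r → Fin r → ℕ)
    (25≤r : 25 ≤ r) (rm≡N+M : r * m ≡ N + M) (N>0 : 0 < N) (M>0 : 0 < M) (e≤NM : e ≤ N * M)
    (a+b≡m : ∀ i → a i + b i ≡ m) (Σa≡N : sumFin a ≡ N) (Σb≡M : sumFin b ≡ M)
    (a-lo : ∀ i → 12 * r * (N + M) * N ≤ 12 * r * (N + M) * (r * a i) + 25 * (N * M))
    (a-hi : ∀ i → 12 * r * (N + M) * (r * a i) ≤ 12 * r * (N + M) * N + 25 * (N * M))
    where

    open ≤-Reasoning

    P l K : ℕ
    P = N * M
    l = N + M
    K = 12 * r * l

    r>0 : 0 < r
    r>0 = ≤-trans (s≤s z≤n) 25≤r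

    5≤r : 5 ≤ r
    5≤r = ≤-trans (m≤n+m 5 20) 25≤r

    l>0 : 0 < l
    l>0 = ≤-trans N>0 (m≤m+n N M)

    P>0 : 0 < P
    P>0 = *-pos N>0 M>0

    P≤Nl : P ≤ N * l
    P≤Nl = *-monoʳ-≤ N (m≤n+m M N)

    P≤Ml : P ≤ M * l
    P≤Ml = subst (_≤ M * l) (*-comm M N) (*-monoʳ-≤ M (m≤m+n N M))

    -- since a i + b i = m and r m = N + M, the bounds transfer to b
    rab≡NM : ∀ i → K * (r * a i) + K * (r * b i) ≡ K * N + K * M
    rab≡NM i = begin-equality
      K * (r * a i) + K * (r * b i) ≡⟨ solve 4 (λ k r x y → k :* (r :* x) :+ k :* (r :* y) := k :* (r :* (x :+ y))) refl K r (a i) (b i) ⟩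
      K * (r * (a i + b i))         ≡⟨ cong (λ t → K * (r * t)) (a+b≡m i) ⟩
      K * (r * m)                   ≡⟨ cong (K *_) rm≡N+M ⟩
      K * (N + M)                   ≡⟨ *-distribˡ-+ K N M ⟩
      K * N + K * M                 ∎

    b-lo : ∀ i → K * M ≤ K * (r * b i) + 25 * P
    b-lo i = +-cancelʳ-≤ (K * (r * a i)) (K * M) (K * (r * b i) + 25 * P) (begin
      K * M + K * (r * a i)                  ≤⟨ +-monoʳ-≤ (K * M) (a-hi i) ⟩
      K * M + (K * N + 25 * P)               ≡⟨ solve 3 (λ x y z → x :+ (y :+ z) := y :+ x :+ z) refl (K * M) (K * N) (25 * P) ⟩
      K * N + K * M + 25 * P                 ≡⟨ cong (_+ 25 * P) (rab≡NM i) ⟨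
      K * (r * a i) + K * (r * b i) + 25 * P ≡⟨ solve 3 (λ x y z → x :+ y :+ z := y :+ z :+ x) refl (K * (r * a i)) (K * (r * b i)) (25 * P) ⟩
      K * (r * b i) + 25 * P + K * (r * a i) ∎)

    b-hi : ∀ i → K * (r * b i) ≤ K * M + 25 * P
    b-hi i = +-cancelʳ-≤ (K * (r * a i)) (K * (r * b i)) (K * M + 25 * P) (begin
      K * (r * b i) + K * (r * a i)          ≡⟨ +-comm (K * (r * b i)) (K * (r * a i)) ⟩
      K * (r * a i) + K * (r * b i)          ≡⟨ rab≡NM i ⟩
      K * N + K * M                          ≤⟨ +-monoˡ-≤ (K * M) (a-lo i) ⟩
      K * (r * a i) + 25 * P + K * M         ≡⟨ solve 3 (λ x y z → x :+ y :+ z := z :+ y :+ x) refl (K * (r * a i)) (25 * P) (K * M) ⟩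
      K * M + 25 * P + K * (r * a i)         ∎)

    a-large : ∀ i → N < 2 * r * a i
    a-large i = more-than-half r (a i) N 5≤r N>0 (cancel-l-lo r l N (a i) P l>0 P≤Nl (a-lo i))

    b-large : ∀ i → M < 2 * r * b i
    b-large i = more-than-half r (b i) M 5≤r M>0 (cancel-l-lo r l M (b i) P l>0 P≤Ml (b-lo i))

    a-pos : ∀ i → 0 < a i
    a-pos i = n≢0⇒n>0 λ a≡0 → n≮0 (subst (N <_) (trans (cong (2 * r *_) a≡0) (*-zeroʳ (2 * r))) (a-large i))

    b-pos : ∀ i → 0 < b i
    b-pos i = n≢0⇒n>0 λ b≡0 → n≮0 (subst (M <_) (trans (cong (2 * r *_) b≡0) (*-zeroʳ (2 * r))) (b-large i))

    a-small : ∀ i → 12 * r * a i ≤ 13 * N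
    a-small i = at-most-13/12 r (a i) N 25≤r (cancel-l-hi r l N (a i) P l>0 P≤Nl (a-hi i))

    b-small : ∀ i → 12 * r * b i ≤ 13 * M
    b-small i = at-most-13/12 r (b i) M 25≤r (cancel-l-hi r l M (b i) P l>0 P≤Ml (b-hi i))

    ab : Fin r → Fin r → ℕ
    ab i j = a i * b j

    w≤ w< w> w= : Fin r → Fin r → ℕ
    w≤ i j = le (toℕ i) (toℕ j)
    w< i j = lt (toℕ i) (toℕ j)
    w> i j = lt (toℕ j) (toℕ i)
    w= i j = eq (toℕ i) (toℕ j)

    S≤ S> S< S= : ℕ
    S≤ = dsum (λ i j → w≤ i j * ab i j)
    S> = dsum (λ i j → w> i j * ab i j)
    S< = dsum (λ i j → w< i j * ab i j)
    S= = dsum (λ i j → w= i j * ab i j)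

    S≤+S>≡P : S≤ + S> ≡ P
    S≤+S>≡P = begin-equality
      S≤ + S>                            ≡⟨ dsum-+ (λ i j → w≤ i j * ab i j) (λ i j → w> i j * ab i j) ⟨
      dsum (λ i j → w≤ i j * ab i j + w> i j * ab i j)
        ≡⟨ dsum-cong (λ i j → trans (sym (*-distribʳ-+ (ab i j) (w≤ i j) (w> i j)))
                                    (trans (cong (_* ab i j) (le+lt≡1 (toℕ i) (toℕ j))) (+-identityʳ (ab i j)))) ⟩
      dsum ab                            ≡⟨ sum-cong (λ i → sum-*ˡ (a i) b) ⟩
      sumFin (λ i → a i * sumFin b)      ≡⟨ sum-*ʳ (sumFin b) a ⟩
      sumFin a * sumFin b                ≡⟨ cong₂ _*_ Σa≡N Σb≡M ⟩
      P                                  ∎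

    S≤≡S<+S= : S≤ ≡ S< + S=
    S≤≡S<+S= = trans
      (dsum-cong (λ i j → trans (cong (_* ab i j) (le≡lt+eq (toℕ i) (toℕ j))) (*-distribʳ-+ (ab i j) (w< i j) (w= i j))))
      (dsum-+ (λ i j → w< i j * ab i j) (λ i j → w= i j * ab i j))

    -- a i b j - a j b i = m (a i - a j), and K r |a i - a j| ≤ 50 P
    swap-blocks : ∀ i j → K * r * (a i * b j) ≤ K * r * (a j * b i) + 50 * P * m
    swap-blocks i j = +-cancelʳ-≤ (K * r * (a j * m)) _ _ (begin
      K * r * (a i * b j) + K * r * (a j * m)        ≡⟨ cong (λ t → K * r * (a i * b j) + K * r * (a j * t)) (sym (a+b≡m i)) ⟩
      K * r * (a i * b j) + K * r * (a j * (a i + b i))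
        ≡⟨ solve 6 (λ k r x y u v → k :* r :* (x :* v) :+ k :* r :* (y :* (x :+ u)) := k :* r :* (y :* u) :+ k :* r :* (x :* (y :+ v))) refl K r (a i) (a j) (b i) (b j) ⟩
      K * r * (a j * b i) + K * r * (a i * (a j + b j)) ≡⟨ cong (λ t → K * r * (a j * b i) + K * r * (a i * t)) (a+b≡m j) ⟩
      K * r * (a j * b i) + K * r * (a i * m)        ≡⟨ cong (K * r * (a j * b i) +_) (solve 4 (λ k r x m → k :* r :* (x :* m) := k :* (r :* x) :* m) refl K r (a i) m) ⟩
      K * r * (a j * b i) + K * (r * a i) * m        ≤⟨ +-monoʳ-≤ (K * r * (a j * b i)) (*-monoˡ-≤ m spread) ⟩
      K * r * (a j * b i) + (K * (r * a j) + 50 * P) * m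
        ≡⟨ solve 6 (λ k r y u p m → k :* r :* (y :* u) :+ (k :* (r :* y) :+ con 50 :* p) :* m := k :* r :* (y :* u) :+ con 50 :* p :* m :+ k :* r :* (y :* m)) refl K r (a j) (b i) P m ⟩
      K * r * (a j * b i) + 50 * P * m + K * r * (a j * m) ∎)
      where
      spread : K * (r * a i) ≤ K * (r * a j) + 50 * P
      spread = begin
        K * (r * a i)                    ≤⟨ a-hi i ⟩
        K * N + 25 * P                   ≤⟨ +-monoˡ-≤ (25 * P) (a-lo j) ⟩
        K * (r * a j) + 25 * P + 25 * P  ≡⟨ solve 2 (λ x p → x :+ con 25 :* p :+ con 25 :* p := x :+ con 50 :* p) refl (K * (r * a j)) P ⟩
        K * (r * a j) + 50 * P           ∎

    -- pairing (i , j) with (j , i): S< exceeds S> by at most 25 P / (12 r)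
    S<-bound : 12 * r * S< ≤ 12 * r * S> + 25 * P
    S<-bound = *-cancelˡ-≤ 2 (cancelˡ (r * r * m) rrm>0 (begin
      r * r * m * (2 * (12 * r * S<))  ≡⟨ solve 3 (λ r m s → r :* r :* m :* (con 2 :* (con 12 :* r :* s)) := con 2 :* (con 12 :* r :* (r :* m) :* r :* s)) refl r m S< ⟩
      2 * (12 * r * (r * m) * r * S<)  ≡⟨ cong (λ k → 2 * (k * r * S<)) K≡12rrm ⟨
      2 * (K * r * S<)                 ≤⟨ *-monoʳ-≤ 2 summed ⟩
      2 * (K * r * S> + 50 * P * m * C) ≡⟨ solve 4 (λ x p m c → con 2 :* (x :+ con 50 :* p :* m :* c) := con 2 :* x :+ con 50 :* p :* m :* (c :+ c)) refl (K * r * S>) P m C ⟩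
      2 * (K * r * S>) + 50 * P * m * (C + C) ≤⟨ +-monoʳ-≤ (2 * (K * r * S>)) (*-monoʳ-≤ (50 * P * m) 2C≤rr) ⟩
      2 * (K * r * S>) + 50 * P * m * (r * (r * 1)) ≡⟨ cong (λ k → 2 * (k * r * S>) + 50 * P * m * (r * (r * 1))) K≡12rrm ⟩
      2 * (12 * r * (r * m) * r * S>) + 50 * P * m * (r * (r * 1))
        ≡⟨ solve 4 (λ r m s p → con 2 :* (con 12 :* r :* (r :* m) :* r :* s) :+ con 50 :* p :* m :* (r :* (r :* con 1)) := r :* r :* m :* (con 2 :* (con 12 :* r :* s :+ con 25 :* p))) refl r m S> P ⟩
      r * r * m * (2 * (12 * r * S> + 25 * P)) ∎))
      where
      C : ℕ
      C = dsum w<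

      2C≤rr : C + C ≤ r * (r * 1)
      2C≤rr = begin
        C + C                          ≡⟨ cong (C +_) (sum-swap w<) ⟩
        C + dsum w>                    ≡⟨ dsum-+ w< w> ⟨
        dsum (λ i j → w< i j + w> i j) ≤⟨ dsum-mono {r} (λ i j → lt+lt≤1 (toℕ i) (toℕ j)) ⟩
        dsum {r} (λ _ _ → 1)           ≡⟨ dsum-const {r} 1 ⟩
        r * (r * 1)                    ∎

      summed : K * r * S< ≤ K * r * S> + 50 * P * m * C
      summed = begin
        K * r * S<                     ≡⟨ dsum-*ˡ (K * r) (λ i j → w< i j * ab i j) ⟨
        dsum (λ i j → K * r * (w< i j * ab i j))
          ≤⟨ dsum-mono pair ⟩
        dsum (λ i j → K * r * (w< i j * (a j * b i)) + 50 * P * m * w< i j)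
          ≡⟨ dsum-+ (λ i j → K * r * (w< i j * (a j * b i))) (λ i j → 50 * P * m * w< i j) ⟩
        dsum (λ i j → K * r * (w< i j * (a j * b i))) + dsum (λ i j → 50 * P * m * w< i j)
          ≡⟨ cong₂ _+_ (trans (dsum-*ˡ (K * r) (λ i j → w< i j * (a j * b i)))
                              (cong (K * r *_) (sum-swap (λ i j → w< i j * (a j * b i)))))
                       (dsum-*ˡ (50 * P * m) w<) ⟩
        K * r * S> + 50 * P * m * C     ∎
        where
        pair : ∀ i j → K * r * (w< i j * ab i j) ≤ K * r * (w< i j * (a j * b i)) + 50 * P * m * w< i j
        pair i j with toℕ i ℕ.<? toℕ j
        ... | no _ = ≤-trans (≤-reflexive (*-zeroʳ (K * r))) z≤n
        ... | yes _ = subst₂ _≤_ (cong (K * r *_) (sym (+-identityʳ (ab i j))))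
                        (cong₂ _+_ (cong (K * r *_) (sym (+-identityʳ (a j * b i)))) (sym (*-identityʳ (50 * P * m))))
                        (swap-blocks i j)

      K≡12rrm : K ≡ 12 * r * (r * m)
      K≡12rrm = cong (12 * r *_) (sym rm≡N+M)

      rrm>0 : 0 < r * r * m
      rrm>0 = *-pos (*-pos r>0 r>0) m>0
        where
        m>0 : 0 < m
        m>0 = ≰⇒> λ m≤0 → <⇒≱ l>0 (≤-trans (≤-reflexive (sym rm≡N+M))
                                    (≤-trans (*-monoʳ-≤ r m≤0) (≤-reflexive (*-zeroʳ r))))

    -- the diagonal pairs: a i b i ≤ (13/12r)² N M, summed over r blocks
    S=-bound : 12 * r * S= ≤ 15 * P
    S=-bound = *-cancelˡ-≤ 12 (≤-trans (cancelˡ r r>0 (begin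
      r * (12 * (12 * r * S=))                     ≡⟨ solve 2 (λ r s → r :* (con 12 :* (con 12 :* r :* s)) := con 12 :* r :* (con 12 :* r :* s)) refl r S= ⟩
      12 * r * (12 * r * S=)                       ≡⟨ cong (λ t → 12 * r * (12 * r * t)) S=≡diagonal ⟩
      12 * r * (12 * r * sumFin (λ i → ab i i))    ≡⟨ cong (12 * r *_) (sum-*ˡ (12 * r) (λ i → ab i i)) ⟨
      12 * r * sumFin (λ i → 12 * r * ab i i)      ≡⟨ sum-*ˡ (12 * r) (λ i → 12 * r * ab i i) ⟨
      sumFin (λ i → 12 * r * (12 * r * ab i i))    ≤⟨ sum-mono diagonal-term ⟩
      sumFin {r} (λ _ → 169 * P)                   ≡⟨ sum-const {r} (169 * P) ⟩
      r * (169 * P)                                ∎)) (begin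
      169 * P                                      ≤⟨ *-monoˡ-≤ P (m≤m+n 169 11) ⟩
      180 * P                                      ≡⟨ solve 1 (λ p → con 180 :* p := con 12 :* (con 15 :* p)) refl P ⟩
      12 * (15 * P)                                ∎))
      where
      S=≡diagonal : S= ≡ sumFin (λ i → ab i i)
      S=≡diagonal = sum-cong λ i → trans
        (sum-point (λ j → w= i j * ab i j) i
           (λ j j≢i → cong (λ t → ind t * ab i j) (⌊⌋-no (toℕ i ℕ.≟ toℕ j) (λ i≡j → j≢i (sym (toℕ-injective i≡j))))))
        (trans (cong (λ t → ind t * ab i i) (⌊⌋-yes (toℕ i ℕ.≟ toℕ i) refl)) (+-identityʳ (ab i i)))

      diagonal-term : ∀ i → 12 * r * (12 * r * ab i i) ≤ 169 * P
      diagonal-term i = begin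
        12 * r * (12 * r * (a i * b i))  ≡⟨ solve 3 (λ r x y → con 12 :* r :* (con 12 :* r :* (x :* y)) := (con 12 :* r :* x) :* (con 12 :* r :* y)) refl r (a i) (b i) ⟩
        (12 * r * a i) * (12 * r * b i)  ≤⟨ *-mono-≤ (a-small i) (b-small i) ⟩
        (13 * N) * (13 * M)              ≡⟨ solve 2 (λ n m → (con 13 :* n) :* (con 13 :* m) := con 169 :* (n :* m)) refl N M ⟩
        169 * P                          ∎

    S≤-bound : 12 * r * S≤ ≤ 12 * r * S> + 40 * P
    S≤-bound = begin
      12 * r * S≤                  ≡⟨ cong (12 * r *_) S≤≡S<+S= ⟩
      12 * r * (S< + S=)           ≡⟨ *-distribˡ-+ (12 * r) S< S= ⟩
      12 * r * S< + 12 * r * S=    ≤⟨ +-mono-≤ S<-bound S=-bound ⟩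
      12 * r * S> + 25 * P + 15 * P ≡⟨ solve 2 (λ x p → x :+ con 25 :* p :+ con 15 :* p := x :+ con 40 :* p) refl (12 * r * S>) P ⟩
      12 * r * S> + 40 * P         ∎

    U V : ℕ
    U = dsum (λ i j → w≤ i j * E i j)
    V = dsum (λ i j → w> i j * E i j)

    -- E i j / (a i b j) is within 1/(2r) of e / P, for all pairs of blocks
    DensitiesClose : Set
    DensitiesClose = ∀ i j → (2 * r * E i j * P < ab i j * P + 2 * r * e * ab i j)
                           × (2 * r * e * ab i j < ab i j * P + 2 * r * E i j * P)

    forward-excess : DensitiesClose → 6 * r * U < 25 * P + 6 * r * V
    forward-excess close = *-cancelˡ-< 2 (6 * r * U) (25 * P + 6 * r * V) (begin-strict
      2 * (6 * r * U)               ≡⟨ solve 2 (λ r u → con 2 :* (con 6 :* r :* u) := con 12 :* r :* u) refl r U ⟩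
      12 * r * U                    ≤⟨ cancelˡ P P>0 scaled ⟩
      46 * P + 12 * r * V           <⟨ +-monoˡ-< (12 * r * V) (*-monoˡ-< P {{>-nonZero P>0}} (s≤s (m≤m+n 46 3))) ⟩
      50 * P + 12 * r * V           ≡⟨ solve 3 (λ p r v → con 50 :* p :+ con 12 :* r :* v := con 2 :* (con 25 :* p :+ con 6 :* r :* v)) refl P r V ⟩
      2 * (25 * P + 6 * r * V)      ∎)
      where
      U-upper : 2 * r * P * U ≤ (P + 2 * r * e) * S≤
      U-upper = begin
        2 * r * P * U                                 ≡⟨ dsum-*ˡ (2 * r * P) (λ i j → w≤ i j * E i j) ⟨
        dsum (λ i j → 2 * r * P * (w≤ i j * E i j))   ≡⟨ dsum-cong (λ i j → solve 4 (λ r p w x → con 2 :* r :* p :* (w :* x) := w :* (con 2 :* r :* x :* p)) refl r P (w≤ i j) (E i j)) ⟩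
        dsum (λ i j → w≤ i j * (2 * r * E i j * P))   ≤⟨ dsum-mono (λ i j → *-monoʳ-≤ (w≤ i j) (<⇒≤ (proj₁ (close i j)))) ⟩
        dsum (λ i j → w≤ i j * (ab i j * P + 2 * r * e * ab i j))
          ≡⟨ dsum-cong (λ i j → solve 5 (λ r p e w x → w :* (x :* p :+ con 2 :* r :* e :* x) := (p :+ con 2 :* r :* e) :* (w :* x)) refl r P e (w≤ i j) (ab i j)) ⟩
        dsum (λ i j → (P + 2 * r * e) * (w≤ i j * ab i j)) ≡⟨ dsum-*ˡ (P + 2 * r * e) (λ i j → w≤ i j * ab i j) ⟩
        (P + 2 * r * e) * S≤                          ∎

      V-lower : 2 * r * e * S> ≤ P * S> + 2 * r * P * V
      V-lower = begin
        2 * r * e * S>                                ≡⟨ dsum-*ˡ (2 * r * e) (λ i j → w> i j * ab i j) ⟨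
        dsum (λ i j → 2 * r * e * (w> i j * ab i j))  ≡⟨ dsum-cong (λ i j → solve 4 (λ r e w x → con 2 :* r :* e :* (w :* x) := w :* (con 2 :* r :* e :* x)) refl r e (w> i j) (ab i j)) ⟩
        dsum (λ i j → w> i j * (2 * r * e * ab i j))  ≤⟨ dsum-mono (λ i j → *-monoʳ-≤ (w> i j) (<⇒≤ (proj₂ (close i j)))) ⟩
        dsum (λ i j → w> i j * (ab i j * P + 2 * r * E i j * P))
          ≡⟨ dsum-cong (λ i j → solve 5 (λ r p w x y → w :* (x :* p :+ con 2 :* r :* y :* p) := p :* (w :* x) :+ con 2 :* r :* p :* (w :* y)) refl r P (w> i j) (ab i j) (E i j)) ⟩
        dsum (λ i j → P * (w> i j * ab i j) + 2 * r * P * (w> i j * E i j))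
          ≡⟨ dsum-+ (λ i j → P * (w> i j * ab i j)) (λ i j → 2 * r * P * (w> i j * E i j)) ⟩
        dsum (λ i j → P * (w> i j * ab i j)) + dsum (λ i j → 2 * r * P * (w> i j * E i j))
          ≡⟨ cong₂ _+_ (dsum-*ˡ P (λ i j → w> i j * ab i j)) (dsum-*ˡ (2 * r * P) (λ i j → w> i j * E i j)) ⟩
        P * S> + 2 * r * P * V                        ∎

      scaled : P * (12 * r * U) ≤ P * (46 * P + 12 * r * V)
      scaled = begin
        P * (12 * r * U)                 ≡⟨ solve 3 (λ p r u → p :* (con 12 :* r :* u) := con 6 :* (con 2 :* r :* p :* u)) refl P r U ⟩
        6 * (2 * r * P * U)              ≤⟨ *-monoʳ-≤ 6 U-upper ⟩
        6 * ((P + 2 * r * e) * S≤)       ≡⟨ solve 4 (λ p r e s → con 6 :* ((p :+ con 2 :* r :* e) :* s) := con 6 :* p :* s :+ e :* (con 12 :* r :* s)) refl P r e S≤ ⟩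
        6 * P * S≤ + e * (12 * r * S≤)   ≤⟨ +-monoʳ-≤ (6 * P * S≤) (*-monoʳ-≤ e S≤-bound) ⟩
        6 * P * S≤ + e * (12 * r * S> + 40 * P)
          ≡⟨ solve 5 (λ p r e s q → con 6 :* p :* q :+ e :* (con 12 :* r :* s :+ con 40 :* p) := con 6 :* p :* q :+ con 6 :* (con 2 :* r :* e :* s) :+ con 40 :* e :* p) refl P r e S> S≤ ⟩
        6 * P * S≤ + 6 * (2 * r * e * S>) + 40 * e * P
          ≤⟨ +-mono-≤ (+-monoʳ-≤ (6 * P * S≤) (*-monoʳ-≤ 6 V-lower)) (*-monoˡ-≤ P (*-monoʳ-≤ 40 e≤NM)) ⟩
        6 * P * S≤ + 6 * (P * S> + 2 * r * P * V) + 40 * P * P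
          ≡⟨ solve 5 (λ p r v s q → con 6 :* p :* q :+ con 6 :* (p :* s :+ con 2 :* r :* p :* v) :+ con 40 :* p :* p := con 6 :* p :* (q :+ s) :+ con 12 :* r :* p :* v :+ con 40 :* p :* p) refl P r V S> S≤ ⟩
        6 * P * (S≤ + S>) + 12 * r * P * V + 40 * P * P
          ≡⟨ cong (λ t → 6 * P * t + 12 * r * P * V + 40 * P * P) S≤+S>≡P ⟩
        6 * P * P + 12 * r * P * V + 40 * P * P
          ≡⟨ solve 3 (λ p r v → con 6 :* p :* p :+ con 12 :* r :* p :* v :+ con 40 :* p :* p := p :* (con 46 :* p :+ con 12 :* r :* v)) refl P r V ⟩
        P * (46 * P + 12 * r * V)        ∎


module RationalScaling where

  open BlockArithmetic using (*-pos)
  open import Defs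
  open import Data.Nat as ℕ using (ℕ; zero; suc)
  import Data.Nat.Properties as ℕP
  open import Data.Nat.Coprimality using (1-coprimeTo)
  import Data.Nat.Coprimality as Coprimality
  open import Data.Integer as ℤ using (+_)
  import Data.Integer.Properties as ℤP
  open import Data.Rational as ℚ
    using (ℚ; mkℚ; 0ℚ; 1ℚ; _/_; _+_; _-_; _*_; _<_; _≤_; -_; *≤*; *<*; NonNegative; Positive)
  open import Data.Rational.Properties as ℚP
    using (normalize-coprime; toℚᵘ-injective; toℚᵘ-homo-*; toℚᵘ-homo-+; toℚᵘ-homo‿-; toℚᵘ-fromℚᵘ)
  open import Data.Rational.Unnormalised as ℚᵘ using (mkℚᵘ; *≡*)
  import Data.Rational.Unnormalised.Properties as ℚᵘP
  open import Data.Rational.Solver using (module +-*-Solver)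
  open +-*-Solver using (solve; _:+_; _:*_; _:-_; :-_; con; _:=_)
  open import Data.Product using (_×_; _,_)
  open import Data.Sum using (inj₁; inj₂)
  open import Relation.Binary.PropositionalEquality
  open import Data.Nat.Solver using () renaming (module +-*-Solver to ℕ-Solver)

  ⟦⟧≡mkℚ : ∀ k → ⟦ k ⟧ ≡ mkℚ (+ k) 0 (Coprimality.sym (1-coprimeTo k))
  ⟦⟧≡mkℚ k = normalize-coprime (Coprimality.sym (1-coprimeTo k))

  ⟦+⟧ : ∀ a b → ⟦ a ℕ.+ b ⟧ ≡ ⟦ a ⟧ + ⟦ b ⟧
  ⟦+⟧ a b rewrite ⟦⟧≡mkℚ a | ⟦⟧≡mkℚ b =
    cong (_/ 1) (sym (cong₂ ℤ._+_ (ℤP.*-identityʳ (+ a)) (ℤP.*-identityʳ (+ b))))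

  ⟦*⟧ : ∀ a b → ⟦ a ℕ.* b ⟧ ≡ ⟦ a ⟧ * ⟦ b ⟧
  ⟦*⟧ a b rewrite ⟦⟧≡mkℚ a | ⟦⟧≡mkℚ b = cong (_/ 1) (ℤP.pos-* a b)

  ⟦≤⟧⁻¹ : ∀ {a b} → ⟦ a ⟧ ≤ ⟦ b ⟧ → a ℕ.≤ b
  ⟦≤⟧⁻¹ {a} {b} a≤b rewrite ⟦⟧≡mkℚ a | ⟦⟧≡mkℚ b with a≤b
  ... | *≤* p = ℤP.drop‿+≤+ (subst₂ ℤ._≤_ (ℤP.*-identityʳ (+ a)) (ℤP.*-identityʳ (+ b)) p)

  ⟦<⟧⁻¹ : ∀ {a b} → ⟦ a ⟧ < ⟦ b ⟧ → a ℕ.< b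
  ⟦<⟧⁻¹ {a} {b} a<b rewrite ⟦⟧≡mkℚ a | ⟦⟧≡mkℚ b with a<b
  ... | *<* p = ℤP.drop‿+<+ (subst₂ ℤ._<_ (ℤP.*-identityʳ (+ a)) (ℤP.*-identityʳ (+ b)) p)

  ⟦<⟧ : ∀ {a b} → a ℕ.< b → ⟦ a ⟧ < ⟦ b ⟧
  ⟦<⟧ {a} {b} a<b rewrite ⟦⟧≡mkℚ a | ⟦⟧≡mkℚ b =
    *<* (subst₂ ℤ._<_ (sym (ℤP.*-identityʳ (+ a))) (sym (ℤP.*-identityʳ (+ b))) (ℤ.+<+ a<b))

  ⟦⟧-injective : ∀ {a b} → ⟦ a ⟧ ≡ ⟦ b ⟧ → a ≡ b
  ⟦⟧-injective a≡b = ℕP.≤-antisym (⟦≤⟧⁻¹ (ℚP.≤-reflexive a≡b)) (⟦≤⟧⁻¹ (ℚP.≤-reflexive (sym a≡b)))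

  ⟦⟧-nonNeg : ∀ k → NonNegative ⟦ k ⟧
  ⟦⟧-nonNeg k rewrite ⟦⟧≡mkℚ k = _

  ⟦⟧-pos : ∀ {k} → 0 ℕ.< k → Positive ⟦ k ⟧
  ⟦⟧-pos {suc k} _ rewrite ⟦⟧≡mkℚ (suc k) = _

  ÷ℕ-* : ∀ k d → 0 ℕ.< d → (k ÷ℕ d) * ⟦ d ⟧ ≡ ⟦ k ⟧
  ÷ℕ-* k (suc d) _ = toℚᵘ-injective (ℚᵘP.≃-trans (toℚᵘ-homo-* (k ÷ℕ suc d) ⟦ suc d ⟧)
    (ℚᵘP.≃-trans (ℚᵘP.*-cong (toℚᵘ-fromℚᵘ (mkℚᵘ (+ k) d)) (toℚᵘ-fromℚᵘ (mkℚᵘ (+ suc d) 0)))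
     (ℚᵘP.≃-trans (*≡* cross) (ℚᵘP.≃-sym (toℚᵘ-fromℚᵘ (mkℚᵘ (+ k) 0))))))
    where
    cross : (+ k ℤ.* + suc d) ℤ.* + 1 ≡ + k ℤ.* + (suc d ℕ.* 1)
    cross = trans (ℤP.*-identityʳ _) (cong (λ t → + k ℤ.* + t) (sym (ℕP.*-identityʳ (suc d))))

  ⟦-⟧ : ∀ a b → (+ a ℤ.- + b) / 1 ≡ ⟦ a ⟧ - ⟦ b ⟧
  ⟦-⟧ a b = toℚᵘ-injective (ℚᵘP.≃-trans (toℚᵘ-fromℚᵘ (mkℚᵘ (+ a ℤ.- + b) 0))
    (ℚᵘP.≃-trans (*≡* cross) (ℚᵘP.≃-sym (ℚᵘP.≃-trans (toℚᵘ-homo-+ ⟦ a ⟧ (- ⟦ b ⟧))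
       (ℚᵘP.+-cong (toℚᵘ-fromℚᵘ (mkℚᵘ (+ a) 0))
                   (ℚᵘP.≃-trans (toℚᵘ-homo‿- ⟦ b ⟧) (ℚᵘP.-‿cong (toℚᵘ-fromℚᵘ (mkℚᵘ (+ b) 0)))))))))
    where
    cross : (+ a ℤ.- + b) ℤ.* + 1 ≡ (+ a ℤ.* + 1 ℤ.+ ℤ.- + b ℤ.* + 1) ℤ.* + 1
    cross = cong (ℤ._* + 1) (sym (cong₂ ℤ._+_ (ℤP.*-identityʳ (+ a)) (ℤP.*-identityʳ (ℤ.- + b))))

  -≤⇒≤+ : ∀ {x y z} → x - y ≤ z → x ≤ z + y
  -≤⇒≤+ {x} {y} {z} h = ℚP.≤-trans (ℚP.≤-reflexive (solve 2 (λ x y → x := x :- y :+ y) refl x y)) (ℚP.+-monoˡ-≤ y h)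

  <-+⇒-< : ∀ {x y z} → z < x + y → z - y < x
  <-+⇒-< {x} {y} {z} h = ℚP.<-≤-trans (ℚP.+-monoˡ-< (- y) h) (ℚP.≤-reflexive (solve 2 (λ x y → x :+ y :- y := x) refl x y))

  -<⇒<+ : ∀ {x y z} → x - y < z → x < z + y
  -<⇒<+ {x} {y} {z} h = ℚP.≤-<-trans (ℚP.≤-reflexive (solve 2 (λ x y → x := x :- y :+ y) refl x y)) (ℚP.+-monoˡ-< y h)

  ∣∣<⇒ : ∀ {x d : ℚ} → ℚ.∣ x ∣ < d → (x < d) × (- x < d)
  ∣∣<⇒ {x} {d} h with ℚP.∣p∣≡p∨∣p∣≡-p x
  ... | inj₁ ∣x∣≡x = x<d , ℚP.≤-<-trans (ℚP.≤-trans (ℚP.neg-antimono-≤ 0≤x) 0≤x) x<d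
    where
    x<d : x < d
    x<d = subst (_< d) ∣x∣≡x h
    0≤x : 0ℚ ≤ x
    0≤x = subst (0ℚ ≤_) ∣x∣≡x (ℚP.0≤∣p∣ x)
  ... | inj₂ ∣x∣≡-x = ℚP.≤-<-trans (ℚP.≤-trans x≤0 0≤-x) -x<d , -x<d
    where
    -x<d : - x < d
    -x<d = subst (_< d) ∣x∣≡-x h
    0≤-x : 0ℚ ≤ - x
    0≤-x = subst (0ℚ ≤_) ∣x∣≡-x (ℚP.0≤∣p∣ x)
    x≤0 : x ≤ 0ℚ
    x≤0 = subst (_≤ 0ℚ) (solve 1 (λ x → :- (:- x) := x) refl x) (ℚP.neg-antimono-≤ 0≤-x)

  ⟦*⟧³ : ∀ a b c → ⟦ a ℕ.* b ℕ.* c ⟧ ≡ ⟦ a ⟧ * ⟦ b ⟧ * ⟦ c ⟧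
  ⟦*⟧³ a b c = trans (⟦*⟧ (a ℕ.* b) c) (cong (_* ⟦ c ⟧) (⟦*⟧ a b))

  ⟦*⟧⁴ : ∀ a b c d → ⟦ a ℕ.* b ℕ.* c ℕ.* d ⟧ ≡ ⟦ a ⟧ * ⟦ b ⟧ * ⟦ c ⟧ * ⟦ d ⟧
  ⟦*⟧⁴ a b c d = trans (⟦*⟧ (a ℕ.* b ℕ.* c) d) (cong (_* ⟦ d ⟧) (⟦*⟧³ a b c))

  δ-of λ-of : ℚ → ℚ
  δ-of ε = (+ 3 / 100) * ε
  λ-of ε = (+ 2 / 1) * δ-of ε

  ζ-of : ℚ → ℚ → ℚ
  ζ-of ε γ = ε * δ-of ε * γ * (1ℚ - γ) * (+ 1 / 4)

  εr≡50/3 : ∀ ε r → ⟦ r ⟧ * λ-of ε ≡ 1ℚ → ε * ⟦ r ⟧ ≡ + 50 / 3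
  εr≡50/3 ε r rλ≡1 = begin
    ε * ⟦ r ⟧                      ≡⟨ solve 2 (λ e x → e :* x := con (+ 50 / 3) :* (x :* (con (+ 2 / 1) :* (con (+ 3 / 100) :* e)))) refl ε ⟦ r ⟧ ⟩
    (+ 50 / 3) * (⟦ r ⟧ * λ-of ε)   ≡⟨ cong ((+ 50 / 3) *_) rλ≡1 ⟩
    + 50 / 3                        ∎
    where open ≡-Reasoning

  r≥34 : ∀ ε r → ε < + 1 / 2 → ⟦ r ⟧ * λ-of ε ≡ 1ℚ → 34 ℕ.≤ r
  r≥34 ε zero _ rλ≡1 with () ← trans (sym (ℚP.*-zeroˡ (λ-of ε))) rλ≡1
  r≥34 ε (suc r') ε<½ rλ≡1 = ℕP.≮⇒≥ λ r<34 → ℕP.<⇒≱ 100<3r (ℕP.≤-trans (ℕP.*-monoʳ-≤ 3 (ℕ.s≤s⁻¹ r<34)) (ℕP.n≤1+n 99))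
    where
    λ<λ½ : λ-of ε < λ-of (+ 1 / 2)
    λ<λ½ = ℚP.*-monoʳ-<-pos (+ 2 / 1) (ℚP.*-monoʳ-<-pos (+ 3 / 100) ε<½)
    1<rλ½ : 1ℚ < ⟦ suc r' ⟧ * λ-of (+ 1 / 2)
    1<rλ½ = subst (_< ⟦ suc r' ⟧ * λ-of (+ 1 / 2)) rλ≡1
              (ℚP.*-monoʳ-<-pos ⟦ suc r' ⟧ {{⟦⟧-pos {suc r'} (ℕ.s≤s ℕ.z≤n)}} λ<λ½)
    100<3r : 100 ℕ.< 3 ℕ.* suc r'
    100<3r = ⟦<⟧⁻¹ (subst₂ _<_ refl
      (trans (solve 1 (λ x → x :* con (λ-of (+ 1 / 2)) :* con ⟦ 100 ⟧ := con ⟦ 3 ⟧ :* x) refl ⟦ suc r' ⟧)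
             (sym (⟦*⟧ 3 (suc r'))))
      (ℚP.*-monoˡ-<-pos ⟦ 100 ⟧ 1<rλ½))

  rm≡l : ∀ ε r m l → ⟦ r ⟧ * λ-of ε ≡ 1ℚ → ⟦ m ⟧ ≡ λ-of ε * ⟦ l ⟧ → r ℕ.* m ≡ l
  rm≡l ε r m l rλ≡1 m≡λl = ⟦⟧-injective (begin
    ⟦ r ℕ.* m ⟧                 ≡⟨ ⟦*⟧ r m ⟩
    ⟦ r ⟧ * ⟦ m ⟧               ≡⟨ cong (⟦ r ⟧ *_) m≡λl ⟩
    ⟦ r ⟧ * (λ-of ε * ⟦ l ⟧)    ≡⟨ ℚP.*-assoc ⟦ r ⟧ (λ-of ε) ⟦ l ⟧ ⟨
    ⟦ r ⟧ * λ-of ε * ⟦ l ⟧      ≡⟨ cong (_* ⟦ l ⟧) rλ≡1 ⟩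
    1ℚ * ⟦ l ⟧                  ≡⟨ ℚP.*-identityˡ ⟦ l ⟧ ⟩
    ⟦ l ⟧                       ∎)
    where open ≡-Reasoning

  -- Once ε r = 50/3 the rational hypotheses and the goal become statements
  -- about naturals: δ = 1/(2r) and ε/4 = 25/(6r).
  module Scaled (ε : ℚ) (r : ℕ) (r>0 : 0 ℕ.< r) (εr : ε * ⟦ r ⟧ ≡ + 50 / 3) where

    open ≡-Reasoning

    δ : ℚ
    δ = δ-of ε

    δ-fraction< : ∀ k a → k ℕ.< 2 ℕ.* r ℕ.* a → δ * ⟦ k ⟧ < ⟦ a ⟧
    δ-fraction< k a k<2ra = ℚP.*-cancelʳ-<-nonNeg ⟦ 2 ℕ.* r ⟧ {{⟦⟧-nonNeg (2 ℕ.* r)}}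
      (subst₂ _<_ (sym δk2r≡k) (sym a2r≡2ra) (⟦<⟧ k<2ra))
      where
      δk2r≡k : δ * ⟦ k ⟧ * ⟦ 2 ℕ.* r ⟧ ≡ ⟦ k ⟧
      δk2r≡k = begin
        δ * ⟦ k ⟧ * ⟦ 2 ℕ.* r ⟧      ≡⟨ cong (δ * ⟦ k ⟧ *_) (⟦*⟧ 2 r) ⟩
        δ * ⟦ k ⟧ * (⟦ 2 ⟧ * ⟦ r ⟧)  ≡⟨ solve 3 (λ e k x → con (+ 3 / 100) :* e :* k :* (con ⟦ 2 ⟧ :* x) := con (+ 6 / 100) :* (e :* x) :* k) refl ε ⟦ k ⟧ ⟦ r ⟧ ⟩
        (+ 6 / 100) * (ε * ⟦ r ⟧) * ⟦ k ⟧ ≡⟨ cong (λ t → (+ 6 / 100) * t * ⟦ k ⟧) εr ⟩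
        (+ 6 / 100) * (+ 50 / 3) * ⟦ k ⟧ ≡⟨ solve 1 (λ k → con (+ 6 / 100) :* con (+ 50 / 3) :* k := k) refl ⟦ k ⟧ ⟩
        ⟦ k ⟧                          ∎
      a2r≡2ra : ⟦ a ⟧ * ⟦ 2 ℕ.* r ⟧ ≡ ⟦ 2 ℕ.* r ℕ.* a ⟧
      a2r≡2ra = trans (sym (⟦*⟧ a (2 ℕ.* r))) (cong ⟦_⟧ (ℕP.*-comm a (2 ℕ.* r)))

    density-gap : ∀ e' e x y → 0 ℕ.< x → 0 ℕ.< y → e' ÷ℕ x - e ÷ℕ y < δ →
                  2 ℕ.* r ℕ.* e' ℕ.* y ℕ.< x ℕ.* y ℕ.+ 2 ℕ.* r ℕ.* e ℕ.* x
    density-gap e' e x y x>0 y>0 gap = ⟦<⟧⁻¹ (subst (⟦ A ⟧ <_) (sym (⟦+⟧ (x ℕ.* y) B))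
      (-<⇒<+ (subst₂ _<_ gap·Q δ·Q (ℚP.*-monoˡ-<-pos Q {{⟦⟧-pos Q>0}} gap))))
      where
      A B : ℕ
      A = 2 ℕ.* r ℕ.* e' ℕ.* y
      B = 2 ℕ.* r ℕ.* e ℕ.* x
      q : ℕ
      q = x ℕ.* y ℕ.* 2 ℕ.* r
      Q : ℚ
      Q = ⟦ q ⟧
      Q>0 : 0 ℕ.< q
      Q>0 = *-pos (*-pos (*-pos x>0 y>0) (ℕ.s≤s ℕ.z≤n)) r>0
      gap·Q : (e' ÷ℕ x - e ÷ℕ y) * Q ≡ ⟦ A ⟧ - ⟦ B ⟧
      gap·Q = begin
        (e' ÷ℕ x - e ÷ℕ y) * Q
          ≡⟨ cong ((e' ÷ℕ x - e ÷ℕ y) *_) (⟦*⟧⁴ x y 2 r) ⟩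
        (e' ÷ℕ x - e ÷ℕ y) * (⟦ x ⟧ * ⟦ y ⟧ * ⟦ 2 ⟧ * ⟦ r ⟧)
          ≡⟨ solve 5 (λ d' d x y r → (d' :- d) :* (x :* y :* con ⟦ 2 ⟧ :* r) := con ⟦ 2 ⟧ :* r :* (d' :* x) :* y :- con ⟦ 2 ⟧ :* r :* (d :* y) :* x) refl (e' ÷ℕ x) (e ÷ℕ y) ⟦ x ⟧ ⟦ y ⟧ ⟦ r ⟧ ⟩
        ⟦ 2 ⟧ * ⟦ r ⟧ * ((e' ÷ℕ x) * ⟦ x ⟧) * ⟦ y ⟧ - ⟦ 2 ⟧ * ⟦ r ⟧ * ((e ÷ℕ y) * ⟦ y ⟧) * ⟦ x ⟧
          ≡⟨ cong₂ (λ s t → ⟦ 2 ⟧ * ⟦ r ⟧ * s * ⟦ y ⟧ - ⟦ 2 ⟧ * ⟦ r ⟧ * t * ⟦ x ⟧) (÷ℕ-* e' x x>0) (÷ℕ-* e y y>0) ⟩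
        ⟦ 2 ⟧ * ⟦ r ⟧ * ⟦ e' ⟧ * ⟦ y ⟧ - ⟦ 2 ⟧ * ⟦ r ⟧ * ⟦ e ⟧ * ⟦ x ⟧
          ≡⟨ cong₂ _-_ (⟦*⟧⁴ 2 r e' y) (⟦*⟧⁴ 2 r e x) ⟨
        ⟦ A ⟧ - ⟦ B ⟧ ∎
      δ·Q : δ * Q ≡ ⟦ x ℕ.* y ⟧
      δ·Q = begin
        δ * Q                                    ≡⟨ cong (δ *_) (⟦*⟧⁴ x y 2 r) ⟩
        δ * (⟦ x ⟧ * ⟦ y ⟧ * ⟦ 2 ⟧ * ⟦ r ⟧)      ≡⟨ solve 4 (λ e x y r → con (+ 3 / 100) :* e :* (x :* y :* con ⟦ 2 ⟧ :* r) := con (+ 6 / 100) :* (e :* r) :* (x :* y)) refl ε ⟦ x ⟧ ⟦ y ⟧ ⟦ r ⟧ ⟩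
        (+ 6 / 100) * (ε * ⟦ r ⟧) * (⟦ x ⟧ * ⟦ y ⟧) ≡⟨ cong (λ t → (+ 6 / 100) * t * (⟦ x ⟧ * ⟦ y ⟧)) εr ⟩
        (+ 6 / 100) * (+ 50 / 3) * (⟦ x ⟧ * ⟦ y ⟧) ≡⟨ solve 1 (λ p → con (+ 6 / 100) :* con (+ 50 / 3) :* p := p) refl (⟦ x ⟧ * ⟦ y ⟧) ⟩
        ⟦ x ⟧ * ⟦ y ⟧                            ≡⟨ ⟦*⟧ x y ⟨
        ⟦ x ℕ.* y ⟧                              ∎

    density-close : ∀ e' e x y → 0 ℕ.< x → 0 ℕ.< y → ℚ.∣ e' ÷ℕ x - e ÷ℕ y ∣ < δ →
      (2 ℕ.* r ℕ.* e' ℕ.* y ℕ.< x ℕ.* y ℕ.+ 2 ℕ.* r ℕ.* e ℕ.* x) ×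
      (2 ℕ.* r ℕ.* e ℕ.* x ℕ.< x ℕ.* y ℕ.+ 2 ℕ.* r ℕ.* e' ℕ.* y)
    density-close e' e x y x>0 y>0 close with ∣∣<⇒ close
    ... | above , below =
      density-gap e' e x y x>0 y>0 above ,
      subst (λ t → 2 ℕ.* r ℕ.* e ℕ.* x ℕ.< t ℕ.+ 2 ℕ.* r ℕ.* e' ℕ.* y) (ℕP.*-comm y x)
        (density-gap e e' y x y>0 x>0
          (subst (_< δ) (solve 2 (λ a b → :- (a :- b) := b :- a) refl (e' ÷ℕ x) (e ÷ℕ y)) below))

    fit-bound : ∀ F B P → 6 ℕ.* r ℕ.* F ℕ.< 25 ℕ.* P ℕ.+ 6 ℕ.* r ℕ.* B →
                ((+ F ℤ.- + B) / 1) < ε * ⟦ P ⟧ * (+ 1 / 4)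
    fit-bound F B P 6rF<25P+6rB rewrite ⟦-⟧ F B =
      ℚP.*-cancelʳ-<-nonNeg ⟦ 6 ℕ.* r ⟧ {{⟦⟧-nonNeg (6 ℕ.* r)}}
        (subst₂ _<_ (sym difference·6r) (sym goal·6r)
           (<-+⇒-< (subst (⟦ 6 ℕ.* r ℕ.* F ⟧ <_) (⟦+⟧ (25 ℕ.* P) (6 ℕ.* r ℕ.* B)) (⟦<⟧ 6rF<25P+6rB))))
      where
      difference·6r : (⟦ F ⟧ - ⟦ B ⟧) * ⟦ 6 ℕ.* r ⟧ ≡ ⟦ 6 ℕ.* r ℕ.* F ⟧ - ⟦ 6 ℕ.* r ℕ.* B ⟧
      difference·6r = begin
        (⟦ F ⟧ - ⟦ B ⟧) * ⟦ 6 ℕ.* r ⟧         ≡⟨ cong ((⟦ F ⟧ - ⟦ B ⟧) *_) (⟦*⟧ 6 r) ⟩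
        (⟦ F ⟧ - ⟦ B ⟧) * (⟦ 6 ⟧ * ⟦ r ⟧)     ≡⟨ solve 3 (λ f b x → (f :- b) :* (con ⟦ 6 ⟧ :* x) := con ⟦ 6 ⟧ :* x :* f :- con ⟦ 6 ⟧ :* x :* b) refl ⟦ F ⟧ ⟦ B ⟧ ⟦ r ⟧ ⟩
        ⟦ 6 ⟧ * ⟦ r ⟧ * ⟦ F ⟧ - ⟦ 6 ⟧ * ⟦ r ⟧ * ⟦ B ⟧ ≡⟨ cong₂ _-_ (⟦*⟧³ 6 r F) (⟦*⟧³ 6 r B) ⟨
        ⟦ 6 ℕ.* r ℕ.* F ⟧ - ⟦ 6 ℕ.* r ℕ.* B ⟧  ∎
      goal·6r : ε * ⟦ P ⟧ * (+ 1 / 4) * ⟦ 6 ℕ.* r ⟧ ≡ ⟦ 25 ℕ.* P ⟧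
      goal·6r = begin
        ε * ⟦ P ⟧ * (+ 1 / 4) * ⟦ 6 ℕ.* r ⟧     ≡⟨ cong (ε * ⟦ P ⟧ * (+ 1 / 4) *_) (⟦*⟧ 6 r) ⟩
        ε * ⟦ P ⟧ * (+ 1 / 4) * (⟦ 6 ⟧ * ⟦ r ⟧) ≡⟨ solve 3 (λ e p x → e :* p :* con (+ 1 / 4) :* (con ⟦ 6 ⟧ :* x) := con (+ 6 / 4) :* (e :* x) :* p) refl ε ⟦ P ⟧ ⟦ r ⟧ ⟩
        (+ 6 / 4) * (ε * ⟦ r ⟧) * ⟦ P ⟧         ≡⟨ cong (λ t → (+ 6 / 4) * t * ⟦ P ⟧) εr ⟩
        (+ 6 / 4) * (+ 50 / 3) * ⟦ P ⟧          ≡⟨ solve 1 (λ p → con (+ 6 / 4) :* con (+ 50 / 3) :* p := con ⟦ 25 ⟧ :* p) refl ⟦ P ⟧ ⟩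
        ⟦ 25 ⟧ * ⟦ P ⟧                           ≡⟨ ⟦*⟧ 25 P ⟨
        ⟦ 25 ℕ.* P ⟧                             ∎

    -- With l = N + M, γ = N / l and r λ = 1, the
    -- hypothesis |X ∩ I_j| ∈ [(γλ - ζ) l , (γλ + ζ) l] reads, after
    -- multiplying by 12 r² l:  |12 r l (r c) - 12 r l N| ≤ 25 N M.
    module Counts (N M : ℕ) (l>0 : 0 ℕ.< N ℕ.+ M) (rλ≡1 : ⟦ r ⟧ * λ-of ε ≡ 1ℚ) where

      l : ℕ
      l = N ℕ.+ M

      γ : ℚ
      γ = N ÷ℕ l

      q : ℕ
      q = 12 ℕ.* r ℕ.* r ℕ.* l

      mean·q : γ * λ-of ε * ⟦ l ⟧ * ⟦ q ⟧ ≡ ⟦ 12 ℕ.* r ℕ.* l ℕ.* N ⟧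
      mean·q = begin
        γ * λ-of ε * ⟦ l ⟧ * ⟦ q ⟧
          ≡⟨ cong (γ * λ-of ε * ⟦ l ⟧ *_) (⟦*⟧⁴ 12 r r l) ⟩
        γ * λ-of ε * ⟦ l ⟧ * (⟦ 12 ⟧ * ⟦ r ⟧ * ⟦ r ⟧ * ⟦ l ⟧)
          ≡⟨ solve 4 (λ g a r l → g :* a :* l :* (con ⟦ 12 ⟧ :* r :* r :* l) := con ⟦ 12 ⟧ :* r :* l :* (g :* l) :* (r :* a)) refl γ (λ-of ε) ⟦ r ⟧ ⟦ l ⟧ ⟩
        ⟦ 12 ⟧ * ⟦ r ⟧ * ⟦ l ⟧ * (γ * ⟦ l ⟧) * (⟦ r ⟧ * λ-of ε)
          ≡⟨ cong₂ (λ s t → ⟦ 12 ⟧ * ⟦ r ⟧ * ⟦ l ⟧ * s * t) (÷ℕ-* N l l>0) rλ≡1 ⟩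
        ⟦ 12 ⟧ * ⟦ r ⟧ * ⟦ l ⟧ * ⟦ N ⟧ * 1ℚ
          ≡⟨ ℚP.*-identityʳ _ ⟩
        ⟦ 12 ⟧ * ⟦ r ⟧ * ⟦ l ⟧ * ⟦ N ⟧
          ≡⟨ ⟦*⟧⁴ 12 r l N ⟨
        ⟦ 12 ℕ.* r ℕ.* l ℕ.* N ⟧ ∎

      slack·q : ζ-of ε γ * ⟦ l ⟧ * ⟦ q ⟧ ≡ ⟦ 25 ℕ.* (N ℕ.* M) ⟧
      slack·q = begin
        ζ-of ε γ * ⟦ l ⟧ * ⟦ q ⟧
          ≡⟨ cong (ζ-of ε γ * ⟦ l ⟧ *_) (⟦*⟧⁴ 12 r r l) ⟩
        ζ-of ε γ * ⟦ l ⟧ * (⟦ 12 ⟧ * ⟦ r ⟧ * ⟦ r ⟧ * ⟦ l ⟧)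
          ≡⟨ solve 4 (λ e g r l → e :* (con (+ 3 / 100) :* e) :* g :* (con 1ℚ :- g) :* con (+ 1 / 4) :* l :* (con ⟦ 12 ⟧ :* r :* r :* l)
                                := con (+ 9 / 100) :* (e :* r) :* (e :* r) :* (g :* l) :* (l :- g :* l)) refl ε γ ⟦ r ⟧ ⟦ l ⟧ ⟩
        (+ 9 / 100) * (ε * ⟦ r ⟧) * (ε * ⟦ r ⟧) * (γ * ⟦ l ⟧) * (⟦ l ⟧ - γ * ⟦ l ⟧)
          ≡⟨ cong₂ (λ s t → (+ 9 / 100) * s * s * t * (⟦ l ⟧ - t)) εr (÷ℕ-* N l l>0) ⟩
        (+ 9 / 100) * (+ 50 / 3) * (+ 50 / 3) * ⟦ N ⟧ * (⟦ l ⟧ - ⟦ N ⟧)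
          ≡⟨ cong (λ t → (+ 9 / 100) * (+ 50 / 3) * (+ 50 / 3) * ⟦ N ⟧ * (t - ⟦ N ⟧)) (⟦+⟧ N M) ⟩
        (+ 9 / 100) * (+ 50 / 3) * (+ 50 / 3) * ⟦ N ⟧ * (⟦ N ⟧ + ⟦ M ⟧ - ⟦ N ⟧)
          ≡⟨ solve 2 (λ n m → con (+ 9 / 100) :* con (+ 50 / 3) :* con (+ 50 / 3) :* n :* (n :+ m :- n) := con ⟦ 25 ⟧ :* (n :* m)) refl ⟦ N ⟧ ⟦ M ⟧ ⟩
        ⟦ 25 ⟧ * (⟦ N ⟧ * ⟦ M ⟧)
          ≡⟨ trans (⟦*⟧ 25 (N ℕ.* M)) (cong (⟦ 25 ⟧ *_) (⟦*⟧ N M)) ⟨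
        ⟦ 25 ℕ.* (N ℕ.* M) ⟧ ∎

      count·q : ∀ c → ⟦ c ⟧ * ⟦ q ⟧ ≡ ⟦ 12 ℕ.* r ℕ.* l ℕ.* (r ℕ.* c) ⟧
      count·q c = trans (sym (⟦*⟧ c q)) (cong ⟦_⟧ (reorder c r l))
        where
        reorder : ∀ c r l → c ℕ.* (12 ℕ.* r ℕ.* r ℕ.* l) ≡ 12 ℕ.* r ℕ.* l ℕ.* (r ℕ.* c)
        reorder = ℕ-Solver.solve 3 (λ c r l → c ℕ-Solver.:* (ℕ-Solver.con 12 ℕ-Solver.:* r ℕ-Solver.:* r ℕ-Solver.:* l)
                                    ℕ-Solver.:= ℕ-Solver.con 12 ℕ-Solver.:* r ℕ-Solver.:* l ℕ-Solver.:* (r ℕ-Solver.:* c)) refl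

      InWindow : ℕ → Set
      InWindow c = ((γ * λ-of ε - ζ-of ε γ) * ⟦ l ⟧ ≤ ⟦ c ⟧) × (⟦ c ⟧ ≤ (γ * λ-of ε + ζ-of ε γ) * ⟦ l ⟧)

      scale : ∀ {x y} → x ≤ y → x * ⟦ q ⟧ ≤ y * ⟦ q ⟧
      scale = ℚP.*-monoʳ-≤-nonNeg ⟦ q ⟧ {{⟦⟧-nonNeg q}}

      count-lower : ∀ c → InWindow c →
                    12 ℕ.* r ℕ.* l ℕ.* N ℕ.≤ 12 ℕ.* r ℕ.* l ℕ.* (r ℕ.* c) ℕ.+ 25 ℕ.* (N ℕ.* M)
      count-lower c (lo , _) = ⟦≤⟧⁻¹ (subst (⟦ 12 ℕ.* r ℕ.* l ℕ.* N ⟧ ≤_) (sym (⟦+⟧ (12 ℕ.* r ℕ.* l ℕ.* (r ℕ.* c)) (25 ℕ.* (N ℕ.* M))))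
        (-≤⇒≤+ (subst₂ _≤_ lower·q (count·q c) (scale lo))))
        where
        lower·q : (γ * λ-of ε - ζ-of ε γ) * ⟦ l ⟧ * ⟦ q ⟧ ≡ ⟦ 12 ℕ.* r ℕ.* l ℕ.* N ⟧ - ⟦ 25 ℕ.* (N ℕ.* M) ⟧
        lower·q = trans (solve 4 (λ a z l q → (a :- z) :* l :* q := a :* l :* q :- z :* l :* q) refl (γ * λ-of ε) (ζ-of ε γ) ⟦ l ⟧ ⟦ q ⟧)
                        (cong₂ _-_ mean·q slack·q)

      count-upper : ∀ c → InWindow c →
                    12 ℕ.* r ℕ.* l ℕ.* (r ℕ.* c) ℕ.≤ 12 ℕ.* r ℕ.* l ℕ.* N ℕ.+ 25 ℕ.* (N ℕ.* M)
      count-upper c (_ , hi) = ⟦≤⟧⁻¹ (subst₂ _≤_ (count·q c) upper·q (scale hi))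
        where
        upper·q : (γ * λ-of ε + ζ-of ε γ) * ⟦ l ⟧ * ⟦ q ⟧ ≡ ⟦ 12 ℕ.* r ℕ.* l ℕ.* N ℕ.+ 25 ℕ.* (N ℕ.* M) ⟧
        upper·q = trans (solve 4 (λ a z l q → (a :+ z) :* l :* q := a :* l :* q :+ z :* l :* q) refl (γ * λ-of ε) (ζ-of ε γ) ⟦ l ⟧ ⟦ q ⟧)
                        (trans (cong₂ _+_ mean·q slack·q) (sym (⟦+⟧ (12 ℕ.* r ℕ.* l ℕ.* N) (25 ℕ.* (N ℕ.* M)))))


open import Defs
open import Data.Nat as ℕ using (ℕ)
open import Data.Fin.Subset using (Subset; _∪_; ∣_∣)
open import Data.Integer using (+_)
open import Data.Rational as ℚ using (ℚ; 0ℚ; 1ℚ; _/_; _+_; _-_; _*_; _<_; _≤_)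
open import Data.Product using (_×_)
open import Relation.Binary.PropositionalEquality using (_≡_)

open FiniteSums
open SubsetSums using (card-∪)
open BlockPartition
open RationalScaling
open BlockArithmetic
open import Data.Fin using (toℕ)
open import Data.Fin.Properties using (toℕ<n)
import Data.Nat.Properties as ℕP
open import Relation.Binary.PropositionalEquality using (sym; trans; subst; cong; cong₂)
open import Data.Fin.Subset.Properties using (p⊆p∪q; q⊆p∪q)

lemma3p4 : (n : ℕ) (ε : ℚ) (L R : Subset n) (D : Arcs n) (X Y : Subset n) (r m : ℕ) →
    let δ = (+ 3 / 100) * ε
        l = ∣ L ∣ ℕ.+ ∣ R ∣
        γ = ∣ L ∣ ÷ℕ l
        λ' = (+ 2 / 1) * δ
        ζ = ε * δ * γ * (1ℚ - γ) * (+ 1 / 4)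
    in 0ℚ < ε → ε < + 1 / 2 →
       Disjoint L R → ArcsIn D L R →
       0 ℕ.< ∣ L ∣ → 0 ℕ.< ∣ R ∣ →
       Disjoint X Y → ∣ X ∣ ≡ ∣ L ∣ → ∣ Y ∣ ≡ ∣ R ∣ →
       ⟦ r ⟧ * λ' ≡ 1ℚ → ⟦ m ⟧ ≡ λ' * ⟦ l ⟧ →
       Regular δ D L R →
       (∀ j → j ℕ.< r →
          ((γ * λ' - ζ) * ⟦ l ⟧ ≤ ⟦ countInInterval X (X ∪ Y) m j ⟧)
          × (⟦ countInInterval X (X ∪ Y) m j ⟧ ≤ (γ * λ' + ζ) * ⟦ l ⟧)) →
       Safe ε D L R X Y
lemma3p4 n ε L R D X Y r m _ ε<½ L∩R=∅ D⊆L×R N>0 M>0 X∩Y=∅ |X|≡N |Y|≡M rλ≡1 m≡λl regular counts τ adm =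
  fit-bound (forward τ D) (backward τ D) P (begin-strict
    6 ℕ.* r ℕ.* forward τ D      ≤⟨ ℕP.*-monoʳ-≤ (6 ℕ.* r) forward≤ ⟩
    6 ℕ.* r ℕ.* U                <⟨ forward-excess close ⟩
    25 ℕ.* P ℕ.+ 6 ℕ.* r ℕ.* V   ≤⟨ ℕP.+-monoʳ-≤ (25 ℕ.* P) (ℕP.*-monoʳ-≤ (6 ℕ.* r) backward≥) ⟩
    25 ℕ.* P ℕ.+ 6 ℕ.* r ℕ.* backward τ D ∎)
  where
  open ℕP.≤-Reasoning
  N M P : ℕ
  N = ∣ L ∣
  M = ∣ R ∣
  P = N ℕ.* M
  l>0 : 0 ℕ.< N ℕ.+ M
  l>0 = ℕP.<-≤-trans N>0 (ℕP.m≤m+n N M)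
  r·m≡l : r ℕ.* m ≡ N ℕ.+ M
  r·m≡l = rm≡l ε r m (N ℕ.+ M) rλ≡1 m≡λl
  instance
    m≢0 : ℕ.NonZero m
    m≢0 = ℕ.≢-nonZero λ m≡0 → ℕP.<⇒≢ l>0 (trans (sym (trans (cong (r ℕ.*_) m≡0) (ℕP.*-zeroʳ r))) r·m≡l)
  |X∪Y| : ∣ X ∪ Y ∣ ≡ r ℕ.* m
  |X∪Y| = trans (card-∪ X Y X∩Y=∅) (trans (cong₂ ℕ._+_ |X|≡N |Y|≡M) (sym r·m≡l))
  25≤r : 25 ℕ.≤ r
  25≤r = ℕP.≤-trans (ℕP.m≤m+n 25 9) (r≥34 ε r ε<½ rλ≡1)
  open Decomposition L R X Y D τ r m adm L∩R=∅ D⊆L×R |X∪Y|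
  open Scaled ε r (ℕP.≤-trans (ℕ.s≤s ℕ.z≤n) 25≤r) (εr≡50/3 ε r rλ≡1)
  open Counts N M l>0 rλ≡1
  count : ∀ i → InWindow ∣ part L i ∣
  count i = subst InWindow (sym (card-Lpart i)) (counts (toℕ i) (toℕ<n i))
  open BlockEstimate r m N M (arcCount D L R) (λ i → ∣ part L i ∣) (λ i → ∣ part R i ∣)
         (λ i j → arcCount D (part L i) (part R j)) 25≤r r·m≡l N>0 M>0 (arcCount≤ D L R)
         part-size (parts-cover L (p⊆p∪q R)) (parts-cover R (q⊆p∪q L R))
         (λ i → count-lower _ (count i)) (λ i → count-upper _ (count i))
    using (U; V; DensitiesClose; forward-excess; a-large; b-large; a-pos; b-pos)
  -- regularity applies to every pair of parts, as they are large enough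
  close : DensitiesClose
  close i j = density-close _ _ _ _ (*-pos (a-pos i) (b-pos j)) (*-pos N>0 M>0)
    (regular (part L i) (part R j) (part⊆ L i) (part⊆ R j) (δ-fraction< N _ (a-large i)) (δ-fraction< M _ (b-large j)))
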